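{- Let $T$ be a $\{1,3\}$-tree. Then the set of vertices of the polytope $\mathcal{Q}_T$ is exactly $\{\mathbbm{1}'_H : H \text{ is a collection of pairwise vertex-disjoint leaf-paths in } T\}$.
   Context: A $\{1,3\}$-tree is a finite tree all of whose nodes have degree $1$ (leaves) or $3$ (internal nodes); $E$ is its edge set and $I$ its set of internal nodes. A leaf-edge is an edge incident with a leaf; a leaf-path is a path in $T$ whose two extreme edges are leaf-edges (a single edge joining two leaves is a leaf-path); the empty collection is allowed. For such a collection $H$, $\mathbbm{1}'_H=(\mathbbm{1}_H,z)\in\mathbb{Z}^E\times\mathbb{Z}^I$, where $\mathbbm{1}_H$ is the characteristic vector of the edge set of $H$ and $z_v=1$ if $v$ is an internal node of some leaf-path in $H$, $z_v=0$ otherwise. $\mathcal{Q}_T\subset\mathbb{R}^E\times\mathbb{R}^I$ is the set of $(w,z)$ such that for every internal node $v$ with incident edges $a,b,c$: $w_a\le w_b+w_c$, $w_b\le w_a+w_c$, $w_c\le w_a+w_b$, $w_a+w_b+w_c=2z_v$, $z_v\le1$; and if $T$ is a single edge $e$, $\mathcal{Q}_T=\{w:0\le w_e\le1\}$.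
   Formalization: The points of $\mathcal{Q}_T$ are taken in ℚ^E × ℚ^I rather than $\mathbb{R}^E\times\mathbb{R}^I$, and the segments in the definition of a vertex have rational endpoints and rational coefficients. -}

module Defs where

open import Data.Nat as ℕ using (ℕ; zero; suc)
open import Data.Fin using (Fin; zero; suc; inject₁; fromℕ; toℕ; _≟_)
open import Data.Bool using (Bool; if_then_else_)
open import Data.Product using (Σ; ∃; ∃-syntax; _×_; _,_; proj₁; proj₂)
open import Data.Sum using (_⊎_)
open import Relation.Binary.PropositionalEquality using (_≡_; _≢_)
open import Relation.Nullary using (¬_; Dec)
open import Relation.Nullary.Decidable using (⌊_⌋; _⊎-dec_)
open import Data.Rational using (ℚ; 0ℚ; 1ℚ; _+_; _*_; _-_; _≤_; _<_)

count : ∀ {m} → (Fin m → Bool) → ℕ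
count {zero}  f = 0
count {suc m} f = (if f zero then 1 else 0) ℕ.+ count (λ i → f (suc i))

record Graph : Set where
  field
    nV nE : ℕ
    ends  : Fin nE → Fin nV × Fin nV

module _ (G : Graph) where
  open Graph G

  Inc : Fin nE → Fin nV → Set
  Inc e v = proj₁ (ends e) ≡ v ⊎ proj₂ (ends e) ≡ v

  inc? : ∀ e v → Dec (Inc e v)
  inc? e v = (proj₁ (ends e) ≟ v) ⊎-dec (proj₂ (ends e) ≟ v)

  Joins : Fin nE → Fin nV → Fin nV → Set
  Joins e u v = ends e ≡ (u , v) ⊎ ends e ≡ (v , u)

  degree : Fin nV → ℕ
  degree v = count (λ e → ⌊ inc? e v ⌋)

  record Path : Set where
    field
      len      : ℕ
      vs       : Fin (suc len) → Fin nV
      es       : Fin len → Fin nE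
      joins    : ∀ i → Joins (es i) (vs (inject₁ i)) (vs (suc i))
      distinct : ∀ i j → vs i ≡ vs j → i ≡ j

    start finish : Fin nV
    start  = vs zero
    finish = vs (fromℕ len)

  open Path public

  NoLoops : Set
  NoLoops = ∀ e → proj₁ (ends e) ≢ proj₂ (ends e)

  NoParallel : Set
  NoParallel = ∀ e f u v → Joins e u v → Joins f u v → e ≡ f

  Connected : Set
  Connected = ∀ u v → Σ Path (λ p → start p ≡ u × finish p ≡ v)

  Acyclic : Set
  Acyclic = ∀ (p : Path) → 2 ℕ.≤ len p → ∀ e → ¬ Joins e (finish p) (start p)

  IsTree : Set
  IsTree = 1 ℕ.≤ nV × NoLoops × NoParallel × Connected × Acyclic

  Is13Tree : Set
  Is13Tree = IsTree × (∀ v → degree v ≡ 1 ⊎ degree v ≡ 3)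

  Leaf : Fin nV → Set
  Leaf v = degree v ≡ 1

  Internal : Set
  Internal = Σ (Fin nV) (λ v → degree v ≡ 3)

  LeafPath : Path → Set
  LeafPath p = 1 ℕ.≤ len p × Leaf (start p) × Leaf (finish p)

  record DisjointLeafPaths : Set where
    field
      size     : ℕ
      paths    : Fin size → Path
      leafpath : ∀ i → LeafPath (paths i)
      disjoint : ∀ i j → i ≢ j → ∀ a b → vs (paths i) a ≢ vs (paths j) b

  open DisjointLeafPaths public

  EdgeOf : DisjointLeafPaths → Fin nE → Set
  EdgeOf H e = ∃[ i ] ∃[ a ] es (paths H i) a ≡ e

  InnerNodeOf : DisjointLeafPaths → Fin nV → Set
  InnerNodeOf H v = ∃[ i ] ∃[ a ]
    (vs (paths H i) a ≡ v × 0 ℕ.< toℕ a × toℕ a ℕ.< len (paths H i))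

  record Point : Set where
    constructor ⟨_,_⟩
    field
      w : Fin nE → ℚ
      z : Internal → ℚ

  open Point public

  _≈P_ : Point → Point → Set
  x ≈P y = (∀ e → w x e ≡ w y e) × (∀ v → z x v ≡ z y v)

  combo : ℚ → Point → Point → Point
  combo l x y = ⟨ (λ e → l * w x e + (1ℚ - l) * w y e)
                , (λ v → l * z x v + (1ℚ - l) * z y v) ⟩

  InQ : Point → Set
  InQ x =
    (∀ (v : Internal) a b c → a ≢ b → a ≢ c → b ≢ c →
       Inc a (proj₁ v) → Inc b (proj₁ v) → Inc c (proj₁ v) →
       (w x a ≤ w x b + w x c) × (w x b ≤ w x a + w x c) ×
       (w x c ≤ w x a + w x b) ×
       (w x a + w x b + w x c ≡ z x v + z x v) × (z x v ≤ 1ℚ))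
    × (nE ≡ 1 → ∀ e → 0ℚ ≤ w x e × w x e ≤ 1ℚ)

  IsVertexQ : Point → Set
  IsVertexQ x = InQ x ×
    (∀ y y' l → InQ y → InQ y' → 0ℚ < l → l < 1ℚ →
       x ≈P combo l y y' → (y ≈P x) × (y' ≈P x))

  IsIndicator' : DisjointLeafPaths → Point → Set
  IsIndicator' H x =
    (∀ e → (EdgeOf H e → w x e ≡ 1ℚ) × (¬ EdgeOf H e → w x e ≡ 0ℚ)) ×
    (∀ v → (InnerNodeOf H (proj₁ v) → z x v ≡ 1ℚ) ×
           (¬ InnerNodeOf H (proj₁ v) → z x v ≡ 0ℚ))

-- Indicator points are integral and satisfy every node constraint, and Q_T lies in
-- the unit cube, so they are extreme.  Conversely let x be a vertex.  A fractional
-- weight cannot sit at an internal node beside two integral ones, so the fractional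
-- edges have no dead ends and any of them lies on a fractional leaf-path.  Moving
-- the weights along that path by ±ε, with signs chosen node by node so that every
-- node constraint keeps holding (z_v moving by half the change at v), exhibits x as
-- a midpoint of two points of Q_T.  Hence x is integral.  Its 1-edges again have no
-- dead ends and, as z_v ≤ 1, meet each internal node at most twice; so the leaf-paths
-- they form are disjoint, and x is the indicator point of their collection.

module Submission where

open import Defs
open import Data.Bool using (Bool; true; false; not; _xor_; if_then_else_)
open import Data.Bool.Properties using (xor-assoc; xor-comm)
open import Data.Empty using (⊥; ⊥-elim)
open import Data.Fin using (Fin; zero; suc; inject₁; fromℕ; toℕ; opposite; inject≤)
import Data.Fin as Fin
open import Data.Fin.Properties
  using (suc-injective; toℕ-injective; toℕ-inject≤; toℕ-inject₁; toℕ<n; toℕ-fromℕ;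
         pigeonhole; inject₁-injective; opposite-involutive; any?)
import Data.Fin.Properties as Fin
open import Data.List using (List; []; _∷_; allFin)
open import Data.List.Membership.Propositional using (_∈_)
open import Data.List.Membership.Propositional.Properties using (∈-allFin)
open import Data.List.Relation.Unary.Any using (here; there)
open import Data.Nat as ℕ using (ℕ; zero; suc; z≤n; s≤s)
import Data.Nat.Properties as ℕ
open import Data.Product using (Σ; ∃; ∃-syntax; ∃₂; _×_; _,_; proj₁; proj₂; uncurry)
open import Data.Rational
  using (ℚ; 0ℚ; 1ℚ; ½; _+_; _*_; _-_; -_; _≤_; _<_; _⊓_; positive; nonNegative)
open import Data.Rational.Properties hiding (_≟_)
import Data.Rational.Properties as ℚ
open import Data.Rational.Solver using (module +-*-Solver)
open +-*-Solver using (solve; _:+_; _:*_; _:-_; :-_; _:=_; con)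
open import Algebra.Properties.CommutativeMonoid.Sum +-0-commutativeMonoid
  using (sum; sum-cong-≗; ∑-distrib-+; sum-replicate-zero)
open import Data.Sum using (_⊎_; inj₁; inj₂; [_,_]; [_,_]′)
open import Function using (_∘_)
open import Function.Bundles using (_⇔_; mk⇔)
open import Relation.Binary.Definitions using (tri<; tri≈; tri>)
open import Relation.Binary.PropositionalEquality hiding ([_])
open import Relation.Nullary using (¬_; Dec; yes; no; ¬?)
open import Relation.Nullary.Decidable using (⌊_⌋; _×-dec_)

p≤q⇒0≤q-p : ∀ {p q} → p ≤ q → 0ℚ ≤ q - p
p≤q⇒0≤q-p {p} {q} h = subst (_≤ q - p) (+-inverseʳ p) (+-monoˡ-≤ (- p) h)

0≤q-p⇒p≤q : ∀ {p q} → 0ℚ ≤ q - p → p ≤ q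
0≤q-p⇒p≤q {p} {q} h =
  subst₂ _≤_ (+-identityˡ p) (solve 2 (λ p q → q :- p :+ p := q) refl p q) (+-monoˡ-≤ p h)

p<q⇒0<q-p : ∀ {p q} → p < q → 0ℚ < q - p
p<q⇒0<q-p {p} {q} h = subst (_< q - p) (+-inverseʳ p) (+-monoˡ-< (- p) h)

0≤-by : ∀ {x y} → x ≡ y → 0ℚ ≤ y → 0ℚ ≤ x
0≤-by e = subst (0ℚ ≤_) (sym e)

0<-by : ∀ {x y} → x ≡ y → 0ℚ < y → 0ℚ < x
0<-by e = subst (0ℚ <_) (sym e)

0≤+ : ∀ {p q} → 0ℚ ≤ p → 0ℚ ≤ q → 0ℚ ≤ p + q
0≤+ = +-mono-≤

0<+ : ∀ {p q} → 0ℚ < p → 0ℚ ≤ q → 0ℚ < p + q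
0<+ = +-mono-<-≤

0≤* : ∀ {p q} → 0ℚ ≤ p → 0ℚ ≤ q → 0ℚ ≤ p * q
0≤* {p} {q} hp hq = subst (_≤ p * q) (*-zeroʳ p) (*-monoˡ-≤-nonNeg p {{nonNegative hp}} hq)

0<* : ∀ {p q} → 0ℚ < p → 0ℚ < q → 0ℚ < p * q
0<* {p} {q} hp hq = subst (_< p * q) (*-zeroʳ p) (*-monoʳ-<-pos p {{positive hp}} hq)

0≤½ : 0ℚ ≤ ½
0≤½ = ≤ᵇ⇒≤ _

0<½ : 0ℚ < ½
0<½ = positive⁻¹ ½

½<1 : ½ < 1ℚ
½<1 = subst₂ _<_ (+-identityˡ ½) refl (+-monoˡ-< ½ 0<½)

≤∧≢⇒< : ∀ {p q} → p ≤ q → p ≢ q → p < q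
≤∧≢⇒< {p} {q} p≤q p≢q with <-cmp p q
... | tri< p<q _ _ = p<q
... | tri≈ _ p≡q _ = ⊥-elim (p≢q p≡q)
... | tri> _ _ p>q = ⊥-elim (<-irrefl refl (<-≤-trans p>q p≤q))

-q≤p⇒0≤p+q : ∀ {p q} → - q ≤ p → 0ℚ ≤ p + q
-q≤p⇒0≤p+q {p} {q} h = 0≤-by (solve 2 (λ q p → p :+ q := p :- (:- q)) refl q p) (p≤q⇒0≤q-p h)

double-injective : ∀ {x y} → x + x ≡ y + y → x ≡ y
double-injective {x} {y} e = begin
  x           ≡⟨ solve 1 (λ x → x := con ½ :* (x :+ x)) refl x ⟩
  ½ * (x + x) ≡⟨ cong (½ *_) e ⟩
  ½ * (y + y) ≡⟨ solve 1 (λ y → con ½ :* (y :+ y) := y) refl y ⟩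
  y           ∎
  where open ≡-Reasoning

0-extreme : ∀ {l x y} → 0ℚ < l → l < 1ℚ → 0ℚ ≤ x → 0ℚ ≤ y →
            0ℚ ≡ l * x + (1ℚ - l) * y → x ≡ 0ℚ × y ≡ 0ℚ
0-extreme {l} {x} {y} 0<l l<1 0≤x 0≤y e = x≡0 , y≡0
  where
  0<1-l : 0ℚ < 1ℚ - l
  0<1-l = p<q⇒0<q-p l<1
  x≡0 : x ≡ 0ℚ
  x≡0 with x ℚ.≟ 0ℚ
  ... | yes x≡0 = x≡0
  ... | no x≢0 = ⊥-elim (<-irrefl e
        (0<+ (0<* 0<l (≤∧≢⇒< 0≤x (x≢0 ∘ sym))) (0≤* (<⇒≤ 0<1-l) 0≤y)))
  y≡0 : y ≡ 0ℚ
  y≡0 with y ℚ.≟ 0ℚ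
  ... | yes y≡0 = y≡0
  ... | no y≢0 = ⊥-elim (<-irrefl (trans e (+-comm (l * x) ((1ℚ - l) * y)))
        (0<+ (0<* 0<1-l (≤∧≢⇒< 0≤y (y≢0 ∘ sym))) (0≤* (<⇒≤ 0<l) 0≤x)))

1-p≡0⇒p≡1 : ∀ {p} → 1ℚ - p ≡ 0ℚ → p ≡ 1ℚ
1-p≡0⇒p≡1 {p} e = begin
  p               ≡⟨ solve 1 (λ p → p := con 1ℚ :- (con 1ℚ :- p)) refl p ⟩
  1ℚ - (1ℚ - p)   ≡⟨ cong (λ r → 1ℚ - r) e ⟩
  1ℚ - 0ℚ         ≡⟨ solve 0 (con 1ℚ :- con 0ℚ := con 1ℚ) refl ⟩
  1ℚ              ∎
  where open ≡-Reasoning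

1-extreme : ∀ {l x y} → 0ℚ < l → l < 1ℚ → x ≤ 1ℚ → y ≤ 1ℚ →
            1ℚ ≡ l * x + (1ℚ - l) * y → x ≡ 1ℚ × y ≡ 1ℚ
1-extreme {l} {x} {y} 0<l l<1 x≤1 y≤1 e =
  let 1-x≡0 , 1-y≡0 = 0-extreme 0<l l<1 (p≤q⇒0≤q-p x≤1) (p≤q⇒0≤q-p y≤1) e′
  in 1-p≡0⇒p≡1 1-x≡0 , 1-p≡0⇒p≡1 1-y≡0
  where
  e′ : 0ℚ ≡ l * (1ℚ - x) + (1ℚ - l) * (1ℚ - y)
  e′ = begin
    0ℚ                           ≡⟨ sym (+-inverseʳ 1ℚ) ⟩
    1ℚ - 1ℚ                      ≡⟨ cong (λ r → 1ℚ - r) e ⟩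
    1ℚ - (l * x + (1ℚ - l) * y)  ≡⟨ solve 3 (λ l x y →
                                      con 1ℚ :- (l :* x :+ (con 1ℚ :- l) :* y)
                                   := l :* (con 1ℚ :- x) :+ (con 1ℚ :- l) :* (con 1ℚ :- y))
                                    refl l x y ⟩
    l * (1ℚ - x) + (1ℚ - l) * (1ℚ - y) ∎
    where open ≡-Reasoning

ZeroOrOne : ℚ → Set
ZeroOrOne q = q ≡ 0ℚ ⊎ q ≡ 1ℚ

zeroOrOne-bounds : ∀ {q} → ZeroOrOne q → 0ℚ ≤ q × q ≤ 1ℚ
zeroOrOne-bounds (inj₁ refl) = ≤ᵇ⇒≤ _ , ≤ᵇ⇒≤ _
zeroOrOne-bounds (inj₂ refl) = ≤ᵇ⇒≤ _ , ≤ᵇ⇒≤ _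

zeroOrOne-extreme : ∀ {l x y p} → 0ℚ < l → l < 1ℚ → 0ℚ ≤ x × x ≤ 1ℚ → 0ℚ ≤ y × y ≤ 1ℚ →
                    ZeroOrOne p → p ≡ l * x + (1ℚ - l) * y → x ≡ p × y ≡ p
zeroOrOne-extreme 0<l l<1 (0≤x , _) (0≤y , _) (inj₁ refl) = 0-extreme 0<l l<1 0≤x 0≤y
zeroOrOne-extreme 0<l l<1 (_ , x≤1) (_ , y≤1) (inj₂ refl) = 1-extreme 0<l l<1 x≤1 y≤1

-- The constraints of Q_T at an internal node

NodeConstraints : ℚ → ℚ → ℚ → ℚ → Set
NodeConstraints a b c z =
  (a ≤ b + c) × (b ≤ a + c) × (c ≤ a + b) × (a + b + c ≡ z + z) × (z ≤ 1ℚ)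

nc-cong : ∀ {a b c z a′ b′ c′ z′} → a ≡ a′ → b ≡ b′ → c ≡ c′ → z ≡ z′ →
          NodeConstraints a′ b′ c′ z′ → NodeConstraints a b c z
nc-cong refl refl refl refl h = h

nc-swap₁₂ : ∀ {a b c z} → NodeConstraints a b c z → NodeConstraints b a c z
nc-swap₁₂ {a} {b} {c} (a≤ , b≤ , c≤ , sum≡ , z≤1) =
  b≤ , a≤ , subst (c ≤_) (+-comm a b) c≤ , trans (cong (_+ c) (+-comm b a)) sum≡ , z≤1

nc-swap₂₃ : ∀ {a b c z} → NodeConstraints a b c z → NodeConstraints a c b z
nc-swap₂₃ {a} {b} {c} (a≤ , b≤ , c≤ , sum≡ , z≤1) =
  subst (a ≤_) (+-comm b c) a≤ , c≤ , b≤ ,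
  trans (solve 3 (λ a b c → a :+ c :+ b := a :+ b :+ c) refl a b c) sum≡ , z≤1

nc-0≤ : ∀ {a b c z} → NodeConstraints a b c z → 0ℚ ≤ a
nc-0≤ {a} {b} {c} (_ , b≤ , c≤ , _) =
  0≤-by (solve 3 (λ a b c → a := con ½ :* ((a :+ c) :- b) :+ con ½ :* ((a :+ b) :- c)) refl a b c)
        (0≤+ (0≤* 0≤½ (p≤q⇒0≤q-p b≤)) (0≤* 0≤½ (p≤q⇒0≤q-p c≤)))

nc-≤1 : ∀ {a b c z} → NodeConstraints a b c z → a ≤ 1ℚ
nc-≤1 {a} {b} {c} {z} (a≤ , _ , _ , sum≡ , z≤1) =
  0≤q-p⇒p≤q (0≤-by e (0≤+ (0≤* 0≤½ (p≤q⇒0≤q-p a≤)) (p≤q⇒0≤q-p z≤1)))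
  where
  e : 1ℚ - a ≡ ½ * ((b + c) - a) + (1ℚ - z)
  e = begin
    1ℚ - a                                       ≡⟨ solve 3 (λ a b c →
                                                      con 1ℚ :- a
                                                   := con ½ :* ((b :+ c) :- a) :+ (con 1ℚ :- con ½ :* (a :+ b :+ c)))
                                                    refl a b c ⟩
    ½ * ((b + c) - a) + (1ℚ - ½ * (a + b + c))   ≡⟨ cong (λ s → ½ * ((b + c) - a) + (1ℚ - ½ * s)) sum≡ ⟩
    ½ * ((b + c) - a) + (1ℚ - ½ * (z + z))       ≡⟨ solve 4 (λ a b c z →
                                                      con ½ :* ((b :+ c) :- a) :+ (con 1ℚ :- con ½ :* (z :+ z))
                                                   := con ½ :* ((b :+ c) :- a) :+ (con 1ℚ :- z))
                                                    refl a b c z ⟩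
    ½ * ((b + c) - a) + (1ℚ - z)                 ∎
    where open ≡-Reasoning

nc-0≤z : ∀ {a b c z} → NodeConstraints a b c z → 0ℚ ≤ z
nc-0≤z {a} {b} {c} {z} h@(_ , _ , _ , sum≡ , _) =
  0≤-by (trans (solve 1 (λ z → z := con ½ :* (z :+ z)) refl z) (cong (½ *_) (sym sum≡)))
        (0≤* 0≤½ (0≤+ (0≤+ (nc-0≤ h) (nc-0≤ (nc-swap₁₂ h))) (nc-0≤ (nc-swap₁₂ (nc-swap₂₃ (nc-swap₁₂ h))))))

nc-1-1-0 : NodeConstraints 1ℚ 1ℚ 0ℚ 1ℚ
nc-1-1-0 = ≤ᵇ⇒≤ _ , ≤ᵇ⇒≤ _ , ≤ᵇ⇒≤ _ , refl , ≤ᵇ⇒≤ _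

nc-0-0-0 : NodeConstraints 0ℚ 0ℚ 0ℚ 0ℚ
nc-0-0-0 = ≤ᵇ⇒≤ _ , ≤ᵇ⇒≤ _ , ≤ᵇ⇒≤ _ , refl , ≤ᵇ⇒≤ _

nc-0-0-0⇒z≡0 : ∀ {z} → NodeConstraints 0ℚ 0ℚ 0ℚ z → z ≡ 0ℚ
nc-0-0-0⇒z≡0 (_ , _ , _ , sum≡ , _) = double-injective (sym sum≡)

¬nc-1-0-0 : ∀ {z} → NodeConstraints 1ℚ 0ℚ 0ℚ z → ⊥
¬nc-1-0-0 (1≤0 , _) = <-irrefl refl (<-≤-trans (positive⁻¹ 1ℚ) 1≤0)

nc-1-1⇒0-1 : ∀ {c z} → NodeConstraints 1ℚ 1ℚ c z → ZeroOrOne c → c ≡ 0ℚ × z ≡ 1ℚ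
nc-1-1⇒0-1 (_ , _ , _ , sum≡ , _) (inj₁ refl) = refl , double-injective (sym sum≡)
nc-1-1⇒0-1 {z = z} (_ , _ , _ , sum≡ , z≤1) (inj₂ refl) =
  ⊥-elim (<-irrefl refl (<-≤-trans 2<z+z (+-mono-≤ z≤1 z≤1)))
  where
  2<z+z : 1ℚ + 1ℚ < z + z
  2<z+z = subst₂ _<_ (+-identityʳ (1ℚ + 1ℚ)) sum≡ (+-monoʳ-< (1ℚ + 1ℚ) (positive⁻¹ 1ℚ))

¬nc-fractional-integral-integral : ∀ {a b c z} → NodeConstraints a b c z → 0ℚ < a → a < 1ℚ →
                           ZeroOrOne b → ZeroOrOne c → ⊥
¬nc-fractional-integral-integral (a≤ , _) 0<a _ (inj₁ refl) (inj₁ refl) = <-irrefl refl (<-≤-trans 0<a a≤)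
¬nc-fractional-integral-integral {a} (_ , b≤ , _) _ a<1 (inj₂ refl) (inj₁ refl) =
  <-irrefl refl (<-≤-trans a<1 (subst (1ℚ ≤_) (+-identityʳ a) b≤))
¬nc-fractional-integral-integral {a} (_ , _ , c≤ , _) _ a<1 (inj₁ refl) (inj₂ refl) =
  <-irrefl refl (<-≤-trans a<1 (subst (1ℚ ≤_) (+-identityʳ a) c≤))
¬nc-fractional-integral-integral {a} {z = z} (_ , _ , _ , sum≡ , z≤1) 0<a _ (inj₂ refl) (inj₂ refl) =
  <-irrefl refl (<-≤-trans 0<a (0≤q-p⇒p≤q (0≤-by e (0≤+ (p≤q⇒0≤q-p z≤1) (p≤q⇒0≤q-p z≤1)))))
  where
  e : 0ℚ - a ≡ (1ℚ - z) + (1ℚ - z)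
  e = begin
    0ℚ - a                                           ≡⟨ solve 2 (λ a z →
                                                          con 0ℚ :- a
                                                       := (con 1ℚ :- z) :+ (con 1ℚ :- z) :+ ((z :+ z) :- (a :+ con 1ℚ :+ con 1ℚ)))
                                                        refl a z ⟩
    (1ℚ - z) + (1ℚ - z) + ((z + z) - (a + 1ℚ + 1ℚ)) ≡⟨ cong (λ s → (1ℚ - z) + (1ℚ - z) + ((z + z) - s)) sum≡ ⟩
    (1ℚ - z) + (1ℚ - z) + ((z + z) - (z + z))       ≡⟨ solve 1 (λ z →
                                                          (con 1ℚ :- z) :+ (con 1ℚ :- z) :+ ((z :+ z) :- (z :+ z))
                                                       := (con 1ℚ :- z) :+ (con 1ℚ :- z))
                                                        refl z ⟩
    (1ℚ - z) + (1ℚ - z)                              ∎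
    where open ≡-Reasoning

nc-shift-both : ∀ {a b c z ε u} → NodeConstraints a b c z →
                ε + ε ≤ (a + b) - c → ε + ε ≤ (1ℚ + 1ℚ) - (a + b + c) → - ε ≤ u → u ≤ ε →
                NodeConstraints (a + u) (b + u) c (z + u)
nc-shift-both {a} {b} {c} {z} {ε} {u} (a≤ , b≤ , _ , sum≡ , _) pair cap -ε≤u u≤ε =
  0≤q-p⇒p≤q (0≤-by (solve 4 (λ a b c u → b :+ u :+ c :- (a :+ u) := (b :+ c) :- a) refl a b c u)
                   (p≤q⇒0≤q-p a≤)) ,
  0≤q-p⇒p≤q (0≤-by (solve 4 (λ a b c u → a :+ u :+ c :- (b :+ u) := (a :+ c) :- b) refl a b c u)
                   (p≤q⇒0≤q-p b≤)) ,
  0≤q-p⇒p≤q (0≤-by (solve 5 (λ a b c u ε →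
                         a :+ u :+ (b :+ u) :- c
                      := ((a :+ b) :- c :- (ε :+ ε)) :+ (u :+ ε) :+ (u :+ ε))
                       refl a b c u ε)
                   (0≤+ (0≤+ (p≤q⇒0≤q-p pair) (-q≤p⇒0≤p+q -ε≤u)) (-q≤p⇒0≤p+q -ε≤u))) ,
  trans (solve 4 (λ a b c u → a :+ u :+ (b :+ u) :+ c := (a :+ b :+ c) :+ (u :+ u)) refl a b c u)
        (trans (cong (_+ (u + u)) sum≡) (solve 2 (λ z u → (z :+ z) :+ (u :+ u) := z :+ u :+ (z :+ u)) refl z u)) ,
  0≤q-p⇒p≤q (0≤-by e (0≤+ (0≤* 0≤½ (p≤q⇒0≤q-p cap)) (p≤q⇒0≤q-p u≤ε)))
  where
  e : 1ℚ - (z + u) ≡ ½ * ((1ℚ + 1ℚ) - (a + b + c) - (ε + ε)) + (ε - u)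
  e = begin
    1ℚ - (z + u)                                     ≡⟨ solve 3 (λ z u ε →
                                                          con 1ℚ :- (z :+ u)
                                                       := con ½ :* ((con 1ℚ :+ con 1ℚ) :- (z :+ z) :- (ε :+ ε)) :+ (ε :- u))
                                                        refl z u ε ⟩
    ½ * ((1ℚ + 1ℚ) - (z + z) - (ε + ε)) + (ε - u)     ≡⟨ cong (λ s → ½ * ((1ℚ + 1ℚ) - s - (ε + ε)) + (ε - u)) (sym sum≡) ⟩
    ½ * ((1ℚ + 1ℚ) - (a + b + c) - (ε + ε)) + (ε - u) ∎
    where open ≡-Reasoning

nc-shift-opposite : ∀ {a b c z ε u} → NodeConstraints a b c z →
                    ε + ε ≤ (b + c) - a → ε + ε ≤ (a + c) - b → - ε ≤ u → u ≤ ε →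
                    NodeConstraints (a + u) (b - u) c z
nc-shift-opposite {a} {b} {c} {z} {ε} {u} (_ , _ , c≤ , sum≡ , z≤1) a-slack b-slack -ε≤u u≤ε =
  0≤q-p⇒p≤q (0≤-by (solve 5 (λ a b c u ε →
                         b :- u :+ c :- (a :+ u)
                      := ((b :+ c) :- a :- (ε :+ ε)) :+ (ε :- u) :+ (ε :- u))
                       refl a b c u ε)
                   (0≤+ (0≤+ (p≤q⇒0≤q-p a-slack) (p≤q⇒0≤q-p u≤ε)) (p≤q⇒0≤q-p u≤ε))) ,
  0≤q-p⇒p≤q (0≤-by (solve 5 (λ a b c u ε →
                         a :+ u :+ c :- (b :- u)
                      := ((a :+ c) :- b :- (ε :+ ε)) :+ (u :+ ε) :+ (u :+ ε))
                       refl a b c u ε)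
                   (0≤+ (0≤+ (p≤q⇒0≤q-p b-slack) (-q≤p⇒0≤p+q -ε≤u)) (-q≤p⇒0≤p+q -ε≤u))) ,
  0≤q-p⇒p≤q (0≤-by (solve 4 (λ a b c u → a :+ u :+ (b :- u) :- c := (a :+ b) :- c) refl a b c u)
                   (p≤q⇒0≤q-p c≤)) ,
  trans (solve 4 (λ a b c u → a :+ u :+ (b :- u) :+ c := a :+ b :+ c) refl a b c u) sum≡ ,
  z≤1

-- Moving a and b apart needs slack in b + c - a and a + c - b, moving them together
-- needs slack in a + b - c and 2 - (a + b + c).  If, say, a + c ≤ b, then the latter
-- two are at least 2a and 2 - 2b.
slack-choice : ∀ {a b c} → 0ℚ < a → a < 1ℚ → 0ℚ < b → b < 1ℚ →
               ¬ (0ℚ < (b + c) - a × 0ℚ < (a + c) - b) →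
               0ℚ < (a + b) - c × 0ℚ < (1ℚ + 1ℚ) - (a + b + c)
slack-choice {a} {b} {c} 0<a a<1 0<b b<1 ¬both with 0ℚ <? (b + c) - a
... | yes a-slack =
  0<-by (solve 3 (λ a b c → (a :+ b) :- c := (a :+ a) :+ (con 0ℚ :- ((a :+ c) :- b))) refl a b c)
        (0<+ (0<+ 0<a (<⇒≤ 0<a)) b-slack≤0) ,
  0<-by (solve 3 (λ a b c → (con 1ℚ :+ con 1ℚ) :- (a :+ b :+ c)
                         := ((con 1ℚ :- b) :+ (con 1ℚ :- b)) :+ (con 0ℚ :- ((a :+ c) :- b))) refl a b c)
        (0<+ (0<+ (p<q⇒0<q-p b<1) (<⇒≤ (p<q⇒0<q-p b<1))) b-slack≤0)
  where
  b-slack≤0 : 0ℚ ≤ 0ℚ - ((a + c) - b)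
  b-slack≤0 = p≤q⇒0≤q-p (≮⇒≥ (λ b-slack → ¬both (a-slack , b-slack)))
... | no ¬a-slack =
  0<-by (solve 3 (λ a b c → (a :+ b) :- c := (b :+ b) :+ (con 0ℚ :- ((b :+ c) :- a))) refl a b c)
        (0<+ (0<+ 0<b (<⇒≤ 0<b)) a-slack≤0) ,
  0<-by (solve 3 (λ a b c → (con 1ℚ :+ con 1ℚ) :- (a :+ b :+ c)
                         := ((con 1ℚ :- a) :+ (con 1ℚ :- a)) :+ (con 0ℚ :- ((b :+ c) :- a))) refl a b c)
        (0<+ (0<+ (p<q⇒0<q-p a<1) (<⇒≤ (p<q⇒0<q-p a<1))) a-slack≤0)
  where
  a-slack≤0 : 0ℚ ≤ 0ℚ - ((b + c) - a)
  a-slack≤0 = p≤q⇒0≤q-p (≮⇒≥ ¬a-slack)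

-- Replacing non-positive values by 1 makes a minimum of slacks positive yet below
-- every positive slack.
posOr1 : ℚ → ℚ
posOr1 q with 0ℚ <? q
... | yes _ = q
... | no _  = 1ℚ

posOr1-pos : ∀ q → 0ℚ < posOr1 q
posOr1-pos q with 0ℚ <? q
... | yes 0<q = 0<q
... | no _    = positive⁻¹ 1ℚ

posOr1-≡ : ∀ {q} → 0ℚ < q → posOr1 q ≡ q
posOr1-≡ {q} 0<q with 0ℚ <? q
... | yes _   = refl
... | no 0≮q = ⊥-elim (0≮q 0<q)

⊓-pos : ∀ {p q} → 0ℚ < p → 0ℚ < q → 0ℚ < p ⊓ q
⊓-pos {p} {q} 0<p 0<q with ⊓-sel p q
... | inj₁ e = subst (0ℚ <_) (sym e) 0<p
... | inj₂ e = subst (0ℚ <_) (sym e) 0<q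

minimum : ∀ {n} → (Fin n → ℚ) → ℚ
minimum {zero}  f = 1ℚ
minimum {suc n} f = f zero ⊓ minimum (f ∘ suc)

minimum-pos : ∀ {n} (f : Fin n → ℚ) → (∀ i → 0ℚ < f i) → 0ℚ < minimum f
minimum-pos {zero}  f pos = positive⁻¹ 1ℚ
minimum-pos {suc n} f pos = ⊓-pos (pos zero) (minimum-pos (f ∘ suc) (pos ∘ suc))

minimum-≤ : ∀ {n} (f : Fin n → ℚ) i → minimum f ≤ f i
minimum-≤ f zero    = p⊓q≤p _ _
minimum-≤ f (suc i) = ≤-trans (p⊓q≤q (f zero) _) (minimum-≤ (f ∘ suc) i)

point : ∀ {n} → Fin n → ℚ → Fin n → ℚ
point zero    q zero    = q
point zero    q (suc j) = 0ℚ
point (suc i) q zero    = 0ℚ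
point (suc i) q (suc j) = point i q j

point-self : ∀ {n} (i : Fin n) q → point i q i ≡ q
point-self zero    q = refl
point-self (suc i) q = point-self i q

point-other : ∀ {n} {i j : Fin n} q → j ≢ i → point i q j ≡ 0ℚ
point-other {i = zero}  {zero}  q j≢i = ⊥-elim (j≢i refl)
point-other {i = zero}  {suc j} q j≢i = refl
point-other {i = suc i} {zero}  q j≢i = refl
point-other {i = suc i} {suc j} q j≢i = point-other q (j≢i ∘ cong suc)

sum-point : ∀ {n} (i : Fin n) q → sum (point i q) ≡ q
sum-point {suc n} zero    q = trans (cong (q +_) (sum-replicate-zero n)) (+-identityʳ q)
sum-point {suc n} (suc i) q = trans (+-identityˡ _) (sum-point i q)

sum-supported-on-three : ∀ {n} (f : Fin n → ℚ) {i j k} → j ≢ i → k ≢ i → k ≢ j →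
                         (∀ e → e ≢ i → e ≢ j → e ≢ k → f e ≡ 0ℚ) →
                         sum f ≡ f i + f j + f k
sum-supported-on-three f {i} {j} {k} j≢i k≢i k≢j vanishes = begin
  sum f                                   ≡⟨ sum-cong-≗ split ⟩
  sum (λ e → pᵢ e + pⱼ e + pₖ e)          ≡⟨ ∑-distrib-+ (λ e → pᵢ e + pⱼ e) pₖ ⟩
  sum (λ e → pᵢ e + pⱼ e) + sum pₖ        ≡⟨ cong (_+ sum pₖ) (∑-distrib-+ pᵢ pⱼ) ⟩
  sum pᵢ + sum pⱼ + sum pₖ                ≡⟨ cong₂ _+_ (cong₂ _+_ (sum-point i (f i)) (sum-point j (f j)))
                                                       (sum-point k (f k)) ⟩
  f i + f j + f k                         ∎
  where
  open ≡-Reasoning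
  pᵢ = point i (f i)
  pⱼ = point j (f j)
  pₖ = point k (f k)
  split : ∀ e → f e ≡ pᵢ e + pⱼ e + pₖ e
  split e with e Fin.≟ i | e Fin.≟ j | e Fin.≟ k
  ... | yes refl | _ | _ =
    sym (trans (cong₂ _+_ (cong₂ _+_ (point-self i (f i)) (point-other _ (j≢i ∘ sym))) (point-other _ (k≢i ∘ sym)))
               (solve 1 (λ x → x :+ con 0ℚ :+ con 0ℚ := x) refl (f i)))
  ... | no e≢i | yes refl | _ =
    sym (trans (cong₂ _+_ (cong₂ _+_ (point-other _ e≢i) (point-self j (f j))) (point-other _ (k≢j ∘ sym)))
               (solve 1 (λ x → con 0ℚ :+ x :+ con 0ℚ := x) refl (f j)))
  ... | no e≢i | no e≢j | yes refl =
    sym (trans (cong₂ _+_ (cong₂ _+_ (point-other _ e≢i) (point-other _ e≢j)) (point-self k (f k)))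
               (solve 1 (λ x → con 0ℚ :+ con 0ℚ :+ x := x) refl (f k)))
  ... | no e≢i | no e≢j | no e≢k =
    trans (vanishes e e≢i e≢j e≢k)
          (sym (cong₂ _+_ (cong₂ _+_ (point-other _ e≢i) (point-other _ e≢j)) (point-other _ e≢k)))

OneOf : ∀ {A : Set} → A → A → A → A → Set
OneOf x a b c = x ≡ a ⊎ x ≡ b ⊎ x ≡ c

without : ∀ {m} → Fin m → (Fin m → Bool) → Fin m → Bool
without zero    f zero    = false
without zero    f (suc i) = f (suc i)
without (suc a) f zero    = f zero
without (suc a) f (suc i) = without a (f ∘ suc) i

count-without : ∀ {m} (a : Fin m) (f : Fin m → Bool) → f a ≡ true → count f ≡ suc (count (without a f))
count-without zero    f fa rewrite fa = refl
count-without (suc a) f fa with f zero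
... | true  = cong suc (count-without a (f ∘ suc) fa)
... | false = count-without a (f ∘ suc) fa

without-keeps : ∀ {m} {a i : Fin m} (f : Fin m → Bool) → f i ≡ true → i ≢ a → without a f i ≡ true
without-keeps {a = zero}  {zero}  f fi i≢a = ⊥-elim (i≢a refl)
without-keeps {a = zero}  {suc i} f fi i≢a = fi
without-keeps {a = suc a} {zero}  f fi i≢a = fi
without-keeps {a = suc a} {suc i} f fi i≢a = without-keeps (f ∘ suc) fi (i≢a ∘ cong suc)

without-true : ∀ {m} {a i : Fin m} (f : Fin m → Bool) → without a f i ≡ true → f i ≡ true × i ≢ a
without-true {a = zero}  {zero}  f ()
without-true {a = zero}  {suc i} f fi = fi , λ ()
without-true {a = suc a} {zero}  f fi = fi , λ ()
without-true {a = suc a} {suc i} f fi =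
  let fi′ , i≢a = without-true (f ∘ suc) fi in fi′ , i≢a ∘ suc-injective

count≡suc⇒true : ∀ {m} (f : Fin m → Bool) {k} → count f ≡ suc k → ∃[ i ] f i ≡ true
count≡suc⇒true {zero}  f ()
count≡suc⇒true {suc m} f eq with f zero in f0
... | true  = zero , f0
... | false = let i , fi = count≡suc⇒true (f ∘ suc) eq in suc i , fi

true⇒count≢0 : ∀ {m} (f : Fin m → Bool) {a} → f a ≡ true → count f ≢ 0
true⇒count≢0 f {a} fa eq with trans (sym (count-without a f fa)) eq
... | ()

count≡1⇒unique : ∀ {m} (f : Fin m → Bool) {a b} → count f ≡ 1 → f a ≡ true → f b ≡ true → a ≡ b
count≡1⇒unique f {a} {b} c≡1 fa fb with b Fin.≟ a
... | yes b≡a = sym b≡a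
... | no b≢a  = ⊥-elim (true⇒count≢0 (without a f) (without-keeps f fb b≢a)
                                     (ℕ.suc-injective (trans (sym (count-without a f fa)) c≡1)))

module _ {m} (f : Fin m → Bool) (c≡3 : count f ≡ 3) where

  count≡3⇒second : ∀ {a} → f a ≡ true → ∃[ b ] f b ≡ true × b ≢ a
  count≡3⇒second {a} fa =
    let b , fb = count≡suc⇒true (without a f) (ℕ.suc-injective (trans (sym (count-without a f fa)) c≡3))
    in b , without-true f fb

  count≡3⇒third : ∀ {a b} → f a ≡ true → f b ≡ true → b ≢ a → ∃[ c ] f c ≡ true × c ≢ a × c ≢ b
  count≡3⇒third {a} {b} fa fb b≢a =
    let c , fc = count≡suc⇒true f₂ count₂
        fc′ , c≢b = without-true f₁ fc
        fc″ , c≢a = without-true f fc′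
    in c , fc″ , c≢a , c≢b
    where
    f₁ = without a f
    f₂ = without b f₁
    count₂ : count f₂ ≡ 1
    count₂ = ℕ.suc-injective (ℕ.suc-injective
               (trans (cong ℕ.suc (sym (count-without b f₁ (without-keeps f fb b≢a))))
                      (trans (sym (count-without a f fa)) c≡3)))

  count≡3⇒only : ∀ {a b c d} → f a ≡ true → f b ≡ true → f c ≡ true → b ≢ a → c ≢ a → c ≢ b →
                 f d ≡ true → OneOf d a b c
  count≡3⇒only {a} {b} {c} {d} fa fb fc b≢a c≢a c≢b fd
    with d Fin.≟ a | d Fin.≟ b | d Fin.≟ c
  ... | yes d≡a | _ | _ = inj₁ d≡a
  ... | no _ | yes d≡b | _ = inj₂ (inj₁ d≡b)
  ... | no _ | no _ | yes d≡c = inj₂ (inj₂ d≡c)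
  ... | no d≢a | no d≢b | no d≢c =
    ⊥-elim (true⇒count≢0 f₃ (without-keeps f₂ (without-keeps f₁ (without-keeps f fd d≢a) d≢b) d≢c) count₃)
    where
    f₁ = without a f
    f₂ = without b f₁
    f₃ = without c f₂
    count₃ : count f₃ ≡ 0
    count₃ = ℕ.suc-injective (ℕ.suc-injective (ℕ.suc-injective
               (trans (cong (ℕ.suc ∘ ℕ.suc) (sym (count-without c f₂ (without-keeps f₁ (without-keeps f fc c≢a) c≢b))))
               (trans (cong ℕ.suc (sym (count-without b f₁ (without-keeps f fb b≢a))))
                      (trans (sym (count-without a f fa)) c≡3)))))

suc≢inject₁ : ∀ {n} {i : Fin n} → suc i ≢ inject₁ i
suc≢inject₁ {i = zero}  ()
suc≢inject₁ {i = suc i} eq = suc≢inject₁ (suc-injective eq)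

opposite-inject₁ : ∀ {m} (j : Fin m) → opposite {suc m} (inject₁ j) ≡ suc (opposite j)
opposite-inject₁ {suc m} zero    = refl
opposite-inject₁ {suc m} (suc j) = cong inject₁ (opposite-inject₁ j)

opposite-fromℕ : ∀ m → opposite {suc m} (fromℕ m) ≡ zero
opposite-fromℕ zero    = refl
opposite-fromℕ (suc m) = cong inject₁ (opposite-fromℕ m)

opposite-injective : ∀ {m} {i j : Fin m} → opposite i ≡ opposite j → i ≡ j
opposite-injective {i = i} {j} e =
  trans (sym (opposite-involutive i)) (trans (cong opposite e) (opposite-involutive j))

propagate-forward : ∀ {n} (R : Fin (suc n) → Set) → (∀ i → R (inject₁ i) → R (suc i)) → R zero → ∀ k → R k
propagate-forward R step r₀ zero = r₀
propagate-forward {suc n} R step r₀ (suc k) = propagate-forward (R ∘ suc) (step ∘ suc) (step zero r₀) k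

propagate-backward : ∀ {n} (R : Fin (suc n) → Set) → (∀ i → R (suc i) → R (inject₁ i)) → ∀ k → R k → R zero
propagate-backward R step zero    rₖ = rₖ
propagate-backward {suc n} R step (suc k) rₖ = step zero (propagate-backward (R ∘ suc) (step ∘ suc) k rₖ)

all-equal⇒one : ∀ {n} (e : Fin n) → (∀ f → f ≡ e) → n ≡ 1
all-equal⇒one {suc zero}    e all = refl
all-equal⇒one {suc (suc n)} e all with trans (all zero) (sym (all (suc zero)))
... | ()

inner-position : ∀ {n} (a : Fin (suc n)) → 0 ℕ.< toℕ a → toℕ a ℕ.< n →
                 ∃₂ λ j₁ j₂ → suc j₁ ≡ a × inject₁ j₂ ≡ a
inner-position (suc j₁) _ a<n = let j₂ , e = lower (suc j₁) a<n in j₁ , j₂ , refl , e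
  where
  lower : ∀ {n} (a : Fin (suc n)) → toℕ a ℕ.< n → ∃[ j ] inject₁ j ≡ a
  lower {suc n} zero    _   = zero , refl
  lower {suc n} (suc a) a<n = let j , e = lower a (ℕ.s≤s⁻¹ a<n) in suc j , cong suc e

last-or-inject₁ : ∀ {n} (k : Fin (suc n)) → k ≡ fromℕ n ⊎ ∃[ i ] k ≡ inject₁ i
last-or-inject₁ {zero}  zero    = inj₁ refl
last-or-inject₁ {suc n} zero    = inj₂ (zero , refl)
last-or-inject₁ {suc n} (suc k) with last-or-inject₁ k
... | inj₁ k≡last   = inj₁ (cong suc k≡last)
... | inj₂ (i , k≡) = inj₂ (suc i , cong suc k≡)

adjacent-step : ∀ {n} → 1 ℕ.≤ n → (a : Fin (suc n)) → ∃[ j ] (inject₁ j ≡ a ⊎ suc j ≡ a)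
adjacent-step {suc n} _ zero    = zero , inj₁ refl
adjacent-step {suc n} _ (suc a) = a , inj₂ refl

module _ {A : Set} (P : A → A → A → Set)
         (swap₁₂ : ∀ {a b c} → P a b c → P b a c) (swap₂₃ : ∀ {a b c} → P a b c → P a c b) where

  permute : ∀ {p q r a b c} → OneOf a p q r → OneOf b p q r → OneOf c p q r →
            a ≢ b → a ≢ c → b ≢ c → P p q r → P a b c
  permute (inj₁ refl)        (inj₁ refl)        _                  a≢b _   _   = ⊥-elim (a≢b refl)
  permute (inj₁ refl)        (inj₂ (inj₁ refl)) (inj₁ refl)        _   a≢c _   = ⊥-elim (a≢c refl)
  permute (inj₁ refl)        (inj₂ (inj₁ refl)) (inj₂ (inj₁ refl)) _   _   b≢c = ⊥-elim (b≢c refl)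
  permute (inj₁ refl)        (inj₂ (inj₁ refl)) (inj₂ (inj₂ refl)) _   _   _   = λ h → h
  permute (inj₁ refl)        (inj₂ (inj₂ refl)) (inj₁ refl)        _   a≢c _   = ⊥-elim (a≢c refl)
  permute (inj₁ refl)        (inj₂ (inj₂ refl)) (inj₂ (inj₁ refl)) _   _   _   = swap₂₃
  permute (inj₁ refl)        (inj₂ (inj₂ refl)) (inj₂ (inj₂ refl)) _   _   b≢c = ⊥-elim (b≢c refl)
  permute (inj₂ (inj₁ refl)) (inj₁ refl)        (inj₁ refl)        _   _   b≢c = ⊥-elim (b≢c refl)
  permute (inj₂ (inj₁ refl)) (inj₁ refl)        (inj₂ (inj₁ refl)) _   a≢c _   = ⊥-elim (a≢c refl)
  permute (inj₂ (inj₁ refl)) (inj₁ refl)        (inj₂ (inj₂ refl)) _   _   _   = swap₁₂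
  permute (inj₂ (inj₁ refl)) (inj₂ (inj₁ refl)) _                  a≢b _   _   = ⊥-elim (a≢b refl)
  permute (inj₂ (inj₁ refl)) (inj₂ (inj₂ refl)) (inj₁ refl)        _   _   _   = swap₂₃ ∘ swap₁₂
  permute (inj₂ (inj₁ refl)) (inj₂ (inj₂ refl)) (inj₂ (inj₁ refl)) _   a≢c _   = ⊥-elim (a≢c refl)
  permute (inj₂ (inj₁ refl)) (inj₂ (inj₂ refl)) (inj₂ (inj₂ refl)) _   _   b≢c = ⊥-elim (b≢c refl)
  permute (inj₂ (inj₂ refl)) (inj₁ refl)        (inj₁ refl)        _   _   b≢c = ⊥-elim (b≢c refl)
  permute (inj₂ (inj₂ refl)) (inj₁ refl)        (inj₂ (inj₁ refl)) _   _   _   = swap₁₂ ∘ swap₂₃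
  permute (inj₂ (inj₂ refl)) (inj₁ refl)        (inj₂ (inj₂ refl)) _   a≢c _   = ⊥-elim (a≢c refl)
  permute (inj₂ (inj₂ refl)) (inj₂ (inj₁ refl)) (inj₁ refl)        _   _   _   = swap₁₂ ∘ swap₂₃ ∘ swap₁₂
  permute (inj₂ (inj₂ refl)) (inj₂ (inj₁ refl)) (inj₂ (inj₁ refl)) _   _   b≢c = ⊥-elim (b≢c refl)
  permute (inj₂ (inj₂ refl)) (inj₂ (inj₁ refl)) (inj₂ (inj₂ refl)) _   a≢c _   = ⊥-elim (a≢c refl)
  permute (inj₂ (inj₂ refl)) (inj₂ (inj₂ refl)) _                  a≢b _   _   = ⊥-elim (a≢b refl)

module GraphFacts (G : Graph) where
  open Graph G

  inc⇒counted : ∀ {e v} → Inc G e v → ⌊ inc? G e v ⌋ ≡ true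
  inc⇒counted {e} {v} h with inc? G e v
  ... | yes _ = refl
  ... | no ¬h = ⊥-elim (¬h h)

  counted⇒inc : ∀ {e v} → ⌊ inc? G e v ⌋ ≡ true → Inc G e v
  counted⇒inc {e} {v} h with inc? G e v
  counted⇒inc {e} {v} h  | yes p = p
  counted⇒inc {e} {v} () | no _

  leaf≢internal : ∀ {v} → Leaf G v → degree G v ≢ 3
  leaf≢internal l d with trans (sym l) d
  ... | ()

  leaf-edge-unique : ∀ {v a b} → Leaf G v → Inc G a v → Inc G b v → a ≡ b
  leaf-edge-unique l ia ib = count≡1⇒unique _ l (inc⇒counted ia) (inc⇒counted ib)

  record Claw (v : Fin nV) (a b c : Fin nE) : Set where
    constructor claw
    field
      a≢b : a ≢ b
      a≢c : a ≢ c
      b≢c : b ≢ c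
      inc-a : Inc G a v
      inc-b : Inc G b v
      inc-c : Inc G c v

  module _ {v} (d3 : degree G v ≡ 3) where

    internal-edge : ∃[ e ] Inc G e v
    internal-edge = let e , ce = count≡suc⇒true _ d3 in e , counted⇒inc ce

    claw-through₂ : ∀ {a b} → Inc G a v → Inc G b v → a ≢ b → ∃[ c ] Claw v a b c
    claw-through₂ ia ib a≢b =
      let c , cc , c≢a , c≢b = count≡3⇒third _ d3 (inc⇒counted ia) (inc⇒counted ib) (a≢b ∘ sym)
      in c , claw a≢b (c≢a ∘ sym) (c≢b ∘ sym) ia ib (counted⇒inc cc)

    claw-through : ∀ {a} → Inc G a v → ∃₂ λ b c → Claw v a b c
    claw-through ia =
      let b , cb , b≢a = count≡3⇒second _ d3 (inc⇒counted ia)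
      in b , claw-through₂ ia (counted⇒inc cb) (b≢a ∘ sym)

    claw-complete : ∀ {a b c e} → Claw v a b c → Inc G e v → OneOf e a b c
    claw-complete (claw a≢b a≢c b≢c ia ib ic) ie =
      count≡3⇒only _ d3 (inc⇒counted ia) (inc⇒counted ib) (inc⇒counted ic)
                   (a≢b ∘ sym) (a≢c ∘ sym) (b≢c ∘ sym) (inc⇒counted ie)

    claw-permute : (P : Fin nE → Fin nE → Fin nE → Set) →
                   (∀ {a b c} → P a b c → P b a c) → (∀ {a b c} → P a b c → P a c b) →
                   ∀ {p q r a b c} → Claw v p q r → Claw v a b c → P p q r → P a b c
    claw-permute P swap₁₂ swap₂₃ k (claw a≢b a≢c b≢c ia ib ic) =
      permute P swap₁₂ swap₂₃ (claw-complete k ia) (claw-complete k ib) (claw-complete k ic) a≢b a≢c b≢c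

  joins-sym : ∀ {e u v} → Joins G e u v → Joins G e v u
  joins-sym (inj₁ p) = inj₂ p
  joins-sym (inj₂ p) = inj₁ p

  joins⇒inc₁ : ∀ {e u v} → Joins G e u v → Inc G e u
  joins⇒inc₁ (inj₁ p) = inj₁ (cong proj₁ p)
  joins⇒inc₁ (inj₂ p) = inj₂ (cong proj₂ p)

  joins⇒inc₂ : ∀ {e u v} → Joins G e u v → Inc G e v
  joins⇒inc₂ = joins⇒inc₁ ∘ joins-sym

  joins-ends : ∀ {e u v x} → Joins G e u v → Inc G e x → x ≡ u ⊎ x ≡ v
  joins-ends (inj₁ p) (inj₁ q) = inj₁ (trans (sym q) (cong proj₁ p))
  joins-ends (inj₁ p) (inj₂ q) = inj₂ (trans (sym q) (cong proj₂ p))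
  joins-ends (inj₂ p) (inj₁ q) = inj₂ (trans (sym q) (cong proj₁ p))
  joins-ends (inj₂ p) (inj₂ q) = inj₁ (trans (sym q) (cong proj₂ p))

  inc⇒joins : ∀ {e v} → Inc G e v → ∃[ u ] Joins G e v u
  inc⇒joins {e} (inj₁ p) = proj₂ (ends e) , inj₁ (cong (_, proj₂ (ends e)) p)
  inc⇒joins {e} (inj₂ p) = proj₁ (ends e) , inj₂ (cong (proj₁ (ends e) ,_) p)

  record IPath (m : ℕ) : Set where
    field
      node           : Fin (suc m) → Fin nV
      edge           : Fin m → Fin nE
      link           : ∀ i → Joins G (edge i) (node (inject₁ i)) (node (suc i))
      node-injective : ∀ i j → node i ≡ node j → i ≡ j

  open IPath public

  toPath : ∀ {m} → IPath m → Path G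
  toPath {m} r = record { len = m ; vs = node r ; es = edge r ; joins = link r ; distinct = node-injective r }

  fromPath : (P : Path G) → IPath (len P)
  fromPath P = record { node = vs P ; edge = es P ; link = joins P ; node-injective = distinct P }

  module _ {m} (r : IPath m) where

    edge-inc₁ : ∀ j → Inc G (edge r j) (node r (inject₁ j))
    edge-inc₁ j = joins⇒inc₁ (link r j)

    edge-inc₂ : ∀ j → Inc G (edge r j) (node r (suc j))
    edge-inc₂ j = joins⇒inc₂ (link r j)

    edge-ends : ∀ j k → Inc G (edge r j) (node r k) → k ≡ inject₁ j ⊎ k ≡ suc j
    edge-ends j k h with joins-ends (link r j) h
    ... | inj₁ p = inj₁ (node-injective r _ _ p)
    ... | inj₂ p = inj₂ (node-injective r _ _ p)

    edge-injective : ∀ i j → edge r i ≡ edge r j → i ≡ j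
    edge-injective i j e
      with edge-ends j (inject₁ i) (subst (λ f → Inc G f (node r (inject₁ i))) e (edge-inc₁ i))
    ... | inj₁ p = inject₁-injective p
    ... | inj₂ p with edge-ends j (suc i) (subst (λ f → Inc G f (node r (suc i))) e (edge-inc₂ i))
    ...   | inj₁ q = ⊥-elim (crossed q (sym p))
      where
      crossed : ∀ {n} {i j : Fin n} → suc i ≡ inject₁ j → suc j ≡ inject₁ i → ⊥
      crossed {i = zero}  {zero}  ()
      crossed {i = zero}  {suc j} _  ()
      crossed {i = suc i} {zero}  ()
      crossed {i = suc i} {suc j} p q = crossed (suc-injective p) (suc-injective q)
    ...   | inj₂ q = suc-injective q

    length<nodes : suc m ℕ.≤ nV
    length<nodes with suc m ℕ.≤? nV
    ... | yes p = p
    ... | no ¬p with pigeonhole (ℕ.≰⇒> ¬p) (node r)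
    ...   | i , j , i<j , e = ⊥-elim (Fin.<-irrefl (node-injective r i j e) i<j)

  prepend : ∀ {m} (r : IPath m) {u f} → Joins G f u (node r zero) → (∀ k → node r k ≢ u) → IPath (suc m)
  prepend {m} r {u} {f} jf fresh = record { node = V ; edge = E ; link = L ; node-injective = I }
    where
    V : Fin (suc (suc m)) → Fin nV
    V zero    = u
    V (suc k) = node r k
    E : Fin (suc m) → Fin nE
    E zero    = f
    E (suc j) = edge r j
    L : ∀ i → Joins G (E i) (V (inject₁ i)) (V (suc i))
    L zero    = jf
    L (suc j) = link r j
    I : ∀ i j → V i ≡ V j → i ≡ j
    I zero    zero    _ = refl
    I zero    (suc j) e = ⊥-elim (fresh j (sym e))
    I (suc i) zero    e = ⊥-elim (fresh i e)
    I (suc i) (suc j) e = cong suc (node-injective r i j e)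

  reverse : ∀ {m} → IPath m → IPath m
  reverse {m} r = record
    { node = node r ∘ opposite ; edge = edge r ∘ opposite ; link = L
    ; node-injective = λ i j e → opposite-injective (node-injective r _ _ e) }
    where
    L : ∀ i → Joins G (edge r (opposite i)) (node r (opposite (inject₁ i))) (node r (opposite (suc i)))
    L i rewrite opposite-inject₁ i = joins-sym (link r (opposite i))

  reverse-finish : ∀ {m} (r : IPath m) → node (reverse r) (fromℕ m) ≡ node r zero
  reverse-finish {m} r = cong (node r) (opposite-fromℕ m)

  reverse-edge : ∀ {m} (r : IPath m) j → edge (reverse r) (opposite j) ≡ edge r j
  reverse-edge r j = cong (edge r) (opposite-involutive j)

  prefix : ∀ {m} (r : IPath m) (k : Fin (suc m)) → IPath (toℕ k)
  prefix {m} r k = record { node = V ; edge = E ; link = L ; node-injective = I }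
    where
    k<1+m : suc (toℕ k) ℕ.≤ suc m
    k<1+m = toℕ<n k
    k≤m : toℕ k ℕ.≤ m
    k≤m = ℕ.s≤s⁻¹ k<1+m
    V : Fin (suc (toℕ k)) → Fin nV
    V i = node r (inject≤ i k<1+m)
    E : Fin (toℕ k) → Fin nE
    E j = edge r (inject≤ j k≤m)
    L : ∀ i → Joins G (E i) (V (inject₁ i)) (V (suc i))
    L i = subst₂ (Joins G (E i)) (cong (node r) (sym left)) (cong (node r) (sym right)) (link r (inject≤ i k≤m))
      where
      left : inject≤ (inject₁ i) k<1+m ≡ inject₁ (inject≤ i k≤m)
      left = toℕ-injective (trans (toℕ-inject≤ (inject₁ i) k<1+m)
               (trans (toℕ-inject₁ i) (trans (sym (toℕ-inject≤ i k≤m)) (sym (toℕ-inject₁ _)))))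
      right : inject≤ (suc i) k<1+m ≡ suc (inject≤ i k≤m)
      right = toℕ-injective (trans (toℕ-inject≤ (suc i) k<1+m) (cong suc (sym (toℕ-inject≤ i k≤m))))
    I : ∀ i j → V i ≡ V j → i ≡ j
    I i j e = toℕ-injective (trans (sym (toℕ-inject≤ i k<1+m))
                (trans (cong toℕ (node-injective r _ _ e)) (toℕ-inject≤ j k<1+m)))

  prefix-finish : ∀ {m} (r : IPath m) (k : Fin (suc m)) → node (prefix r k) (fromℕ (toℕ k)) ≡ node r k
  prefix-finish r k =
    cong (node r) (toℕ-injective (trans (toℕ-inject≤ (fromℕ (toℕ k)) (toℕ<n k)) (toℕ-fromℕ (toℕ k))))

  edge-path : ∀ e → proj₁ (ends e) ≢ proj₂ (ends e) → IPath 1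
  edge-path e no-loop = record
    { node = V ; edge = λ _ → e ; link = λ { zero → inj₁ refl } ; node-injective = I }
    where
    V : Fin 2 → Fin nV
    V zero       = proj₁ (ends e)
    V (suc zero) = proj₂ (ends e)
    I : ∀ i j → V i ≡ V j → i ≡ j
    I zero       zero       _ = refl
    I zero       (suc zero) p = ⊥-elim (no-loop p)
    I (suc zero) zero       p = ⊥-elim (no-loop (sym p))
    I (suc zero) (suc zero) _ = refl

module TreeFacts (T : Graph) (isT : Is13Tree T) where
  open Graph T
  open GraphFacts T

  no-loops : NoLoops T
  no-loops = proj₁ (proj₂ (proj₁ isT))

  no-parallel : NoParallel T
  no-parallel = proj₁ (proj₂ (proj₂ (proj₁ isT)))

  connected : Connected T
  connected = proj₁ (proj₂ (proj₂ (proj₂ (proj₁ isT))))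

  acyclic : Acyclic T
  acyclic = proj₂ (proj₂ (proj₂ (proj₂ (proj₁ isT))))

  leaf-or-internal : ∀ v → Leaf T v ⊎ degree T v ≡ 3
  leaf-or-internal = proj₂ isT

  ¬joins-self : ∀ {e u} → ¬ Joins T e u u
  ¬joins-self {e} (inj₁ p) = no-loops e (trans (cong proj₁ p) (sym (cong proj₂ p)))
  ¬joins-self {e} (inj₂ p) = no-loops e (trans (cong proj₁ p) (sym (cong proj₂ p)))

  -- A new neighbour t of the start would close a loop, a parallel edge or a cycle.
  new-neighbour-fresh : ∀ {m} (r : IPath (suc m)) {f t} → f ≢ edge r zero →
                        Joins T f (node r zero) t → ∀ k → node r k ≢ t
  new-neighbour-fresh r {f} f≢e jf zero e =
    ¬joins-self (subst (Joins T f (node r zero)) (sym e) jf)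
  new-neighbour-fresh r {f} f≢e jf (suc zero) e =
    f≢e (no-parallel f (edge r zero) _ _ (subst (Joins T f (node r zero)) (sym e) jf) (link r zero))
  new-neighbour-fresh r {f} f≢e jf (suc (suc k)) e =
    acyclic (toPath (prefix r (suc (suc k)))) (s≤s (s≤s z≤n)) f
      (subst₂ (Joins T f) (sym (trans (prefix-finish r (suc (suc k))) e)) refl (joins-sym jf))

  leaf-leaf-edge⇒single : ∀ e → Leaf T (proj₁ (ends e)) → Leaf T (proj₂ (ends e)) → nE ≡ 1
  leaf-leaf-edge⇒single e leaf₁ leaf₂ = all-equal⇒one e λ f →
    let P , start≡ , finish≡ = connected (proj₁ (ends e)) (proj₁ (ends f))
        on-e = propagate-forward (λ k → OnE (vs P k)) (step P) (inj₁ start≡) (fromℕ (len P))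
    in at-end f (subst (Inc T f) (sym finish≡) (inj₁ refl)) on-e
    where
    OnE : Fin nV → Set
    OnE x = x ≡ proj₁ (ends e) ⊎ x ≡ proj₂ (ends e)
    at-end : ∀ f {x} → Inc T f x → OnE x → f ≡ e
    at-end f if (inj₁ refl) = leaf-edge-unique leaf₁ if (inj₁ refl)
    at-end f if (inj₂ refl) = leaf-edge-unique leaf₂ if (inj₂ refl)
    step : (P : Path T) → ∀ i → OnE (vs P (inject₁ i)) → OnE (vs P (suc i))
    step P i on with at-end (es P i) (joins⇒inc₁ (joins P i)) on
    ... | refl = joins-ends (inj₁ refl) (joins⇒inc₂ (joins P i))

  NoDeadEnds : (Fin nE → Set) → Set
  NoDeadEnds S = ∀ {v e} → degree T v ≡ 3 → S e → Inc T e v → ∃[ f ] S f × f ≢ e × Inc T f v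

  module _ (S : Fin nE → Set) (no-dead-ends : NoDeadEnds S) where

    record LeafExtension {m} (r : IPath (suc m)) : Set where
      field
        {length}    : ℕ
        path        : IPath (suc length)
        along-S     : ∀ j → S (edge path j)
        leaf-start  : Leaf T (node path zero)
        same-finish : node path (fromℕ (suc length)) ≡ node r (fromℕ (suc m))
        keeps-edges : ∀ j → ∃[ j′ ] edge path j′ ≡ edge r j

    extend-to-leaf : ∀ fuel {m} (r : IPath (suc m)) → (∀ j → S (edge r j)) →
                     nV ℕ.≤ suc m ℕ.+ fuel → LeafExtension r
    extend-to-leaf fuel r along bound with leaf-or-internal (node r zero)
    ... | inj₁ leaf = record { path = r ; along-S = along ; leaf-start = leaf
                             ; same-finish = refl ; keeps-edges = λ j → j , refl }
    ... | inj₂ d3 with no-dead-ends d3 (along zero) (edge-inc₁ r zero)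
    ...   | f , sf , f≢e , if with inc⇒joins if
    ...     | t , jft = continue fuel bound
      where
      r′ = prepend r (joins-sym jft) (new-neighbour-fresh r f≢e jft)
      along′ : ∀ j → S (edge r′ j)
      along′ zero    = sf
      along′ (suc j) = along j
      continue : ∀ fuel → nV ℕ.≤ suc _ ℕ.+ fuel → LeafExtension r
      continue zero bound = ⊥-elim (ℕ.<-irrefl refl
        (ℕ.≤-trans (ℕ.n≤1+n _) (ℕ.≤-trans (length<nodes r′) (subst (nV ℕ.≤_) (ℕ.+-identityʳ _) bound))))
      continue (suc fuel) bound =
        let ext = extend-to-leaf fuel r′ along′ (subst (nV ℕ.≤_) (ℕ.+-suc _ fuel) bound)
            open LeafExtension ext
        in record { path = path ; along-S = along-S ; leaf-start = leaf-start
                  ; same-finish = same-finish ; keeps-edges = keeps-edges ∘ suc }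

    record LeafPathThrough (e : Fin nE) : Set where
      field
        path      : Path T
        leaf-path : LeafPath T path
        along-S   : ∀ j → S (es path j)
        through   : ∃[ j ] es path j ≡ e

    leaf-path-through : ∀ {e} → S e → LeafPathThrough e
    leaf-path-through {e} se = record
      { path = toPath (LeafExtension.path ext₂)
      ; leaf-path = s≤s z≤n , LeafExtension.leaf-start ext₂ ,
                    subst (Leaf T) (sym (trans (LeafExtension.same-finish ext₂) (reverse-finish r₁)))
                          (LeafExtension.leaf-start ext₁)
      ; along-S = LeafExtension.along-S ext₂
      ; through = j₂ , trans e₂ (trans (reverse-edge r₁ j₁) e₁) }
      where
      ext₁ = extend-to-leaf nV (edge-path e (no-loops e)) (λ _ → se) (ℕ.n≤1+n nV)
      r₁ = LeafExtension.path ext₁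
      j₁ = proj₁ (LeafExtension.keeps-edges ext₁ zero)
      e₁ = proj₂ (LeafExtension.keeps-edges ext₁ zero)
      ext₂ = extend-to-leaf nV (reverse r₁) (LeafExtension.along-S ext₁ ∘ opposite) (ℕ.m≤n+m nV _)
      j₂ = proj₁ (LeafExtension.keeps-edges ext₂ (opposite j₁))
      e₂ = proj₂ (LeafExtension.keeps-edges ext₂ (opposite j₁))

  leaf-or-inner-position : (P : Path T) → LeafPath T P → ∀ a →
                           Leaf T (vs P a) ⊎ (0 ℕ.< toℕ a × toℕ a ℕ.< len P)
  leaf-or-inner-position P (_ , leaf-start , leaf-finish) a with toℕ a ℕ.≟ 0 | toℕ a ℕ.<? len P
  ... | yes a≡0 | _ = inj₁ (subst (Leaf T ∘ vs P) (sym (toℕ-injective {i = a} {j = zero} a≡0)) leaf-start)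
  ... | no a≢0 | yes a<len = inj₂ (ℕ.n≢0⇒n>0 a≢0 , a<len)
  ... | no _   | no a≮len = inj₁ (subst (Leaf T ∘ vs P) (sym a≡last) leaf-finish)
    where
    a≡last : a ≡ fromℕ (len P)
    a≡last = toℕ-injective (trans (ℕ.≤-antisym (ℕ.s≤s⁻¹ (toℕ<n a)) (ℕ.≮⇒≥ a≮len)) (sym (toℕ-fromℕ _)))

module PointFacts (T : Graph) (isT : Is13Tree T) where
  open Graph T
  open GraphFacts T
  open TreeFacts T isT

  ClawConstraints : Point T → Set
  ClawConstraints x = ∀ {v a b c} (d3 : degree T v ≡ 3) → Claw v a b c →
                      NodeConstraints (w x a) (w x b) (w x c) (z x (v , d3))

  SingleEdgeBounds : Point T → Set
  SingleEdgeBounds x = nE ≡ 1 → ∀ e → 0ℚ ≤ w x e × w x e ≤ 1ℚ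

  inQ⇒claw-constraints : ∀ {x} → InQ T x → ClawConstraints x
  inQ⇒claw-constraints inQ d3 (claw a≢b a≢c b≢c ia ib ic) = proj₁ inQ (_ , d3) _ _ _ a≢b a≢c b≢c ia ib ic

  claw-constraints⇒inQ : ∀ {x} → ClawConstraints x → SingleEdgeBounds x → InQ T x
  claw-constraints⇒inQ constraints single =
    (λ (v , d3) a b c a≢b a≢c b≢c ia ib ic → constraints d3 (claw a≢b a≢c b≢c ia ib ic)) , single

  nc-any-claw : ∀ (W : Fin nE → ℚ) Z {v p q r a b c} → degree T v ≡ 3 → Claw v p q r → Claw v a b c →
                NodeConstraints (W p) (W q) (W r) Z → NodeConstraints (W a) (W b) (W c) Z
  nc-any-claw W Z d3 = claw-permute d3 (λ a b c → NodeConstraints (W a) (W b) (W c) Z) nc-swap₁₂ nc-swap₂₃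

  module _ {x} (inQ : InQ T x) where

    private
      edge-bounds-at : ∀ {e v} (d3 : degree T v ≡ 3) → Inc T e v → 0ℚ ≤ w x e × w x e ≤ 1ℚ
      edge-bounds-at d3 ie =
        let _ , _ , k = claw-through d3 ie
            h = inQ⇒claw-constraints inQ d3 k
        in nc-0≤ h , nc-≤1 h

    w-bounds : ∀ e → 0ℚ ≤ w x e × w x e ≤ 1ℚ
    w-bounds e with leaf-or-internal (proj₁ (ends e)) | leaf-or-internal (proj₂ (ends e))
    ... | inj₂ d3 | _       = edge-bounds-at d3 (inj₁ refl)
    ... | inj₁ _  | inj₂ d3 = edge-bounds-at d3 (inj₂ refl)
    ... | inj₁ l₁ | inj₁ l₂ = proj₂ inQ (leaf-leaf-edge⇒single e l₁ l₂) e

    z-bounds : ∀ v → 0ℚ ≤ z x v × z x v ≤ 1ℚ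
    z-bounds (v , d3) =
      let e , ie = internal-edge d3
          _ , _ , k = claw-through d3 ie
          h = inQ⇒claw-constraints inQ d3 k
          _ , _ , _ , _ , z≤1 = h
      in nc-0≤z h , z≤1

  -- Indicator points are vertices

  module Collection (H : DisjointLeafPaths T) where

    edgeOf? : ∀ e → Dec (EdgeOf T H e)
    edgeOf? e = any? λ i → any? λ a → es (paths H i) a Fin.≟ e

    innerNodeOf? : ∀ v → Dec (InnerNodeOf T H v)
    innerNodeOf? v = any? λ i → any? λ a →
      (vs (paths H i) a Fin.≟ v) ×-dec (0 ℕ.<? toℕ a ×-dec toℕ a ℕ.<? len (paths H i))

    internal-on-path⇒inner : ∀ {v} i a → degree T v ≡ 3 → vs (paths H i) a ≡ v → InnerNodeOf T H v
    internal-on-path⇒inner i a d3 refl with leaf-or-inner-position (paths H i) (leafpath H i) a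
    ... | inj₁ leaf  = ⊥-elim (leaf≢internal leaf d3)
    ... | inj₂ inner = i , a , refl , inner

    edge⇒inner : ∀ {v g} → degree T v ≡ 3 → Inc T g v → EdgeOf T H g → InnerNodeOf T H v
    edge⇒inner d3 ig (i , j , refl) with joins-ends (joins (paths H i) j) ig
    ... | inj₁ v≡ = internal-on-path⇒inner i (inject₁ j) d3 (sym v≡)
    ... | inj₂ v≡ = internal-on-path⇒inner i (suc j) d3 (sym v≡)

    record PassingThrough (v : Fin nV) : Set where
      field
        g₁ g₂  : Fin nE
        g₁≢g₂  : g₁ ≢ g₂
        inc₁   : Inc T g₁ v
        inc₂   : Inc T g₂ v
        edge₁  : EdgeOf T H g₁
        edge₂  : EdgeOf T H g₂
        only   : ∀ {g} → Inc T g v → EdgeOf T H g → g ≡ g₁ ⊎ g ≡ g₂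

    inner⇒passing : ∀ {v} → InnerNodeOf T H v → PassingThrough v
    inner⇒passing {v} (i , a , refl , 0<a , a<len) = record
      { g₁ = es P j₁ ; g₂ = es P j₂
      ; g₁≢g₂ = λ e → suc≢inject₁ (sym (trans (cong inject₁ (edge-injective r j₁ j₂ e)) s₂′))
      ; inc₁ = subst (Inc T (es P j₁) ∘ vs P) s₁ (edge-inc₂ r j₁)
      ; inc₂ = subst (Inc T (es P j₂) ∘ vs P) s₂ (edge-inc₁ r j₂)
      ; edge₁ = i , j₁ , refl ; edge₂ = i , j₂ , refl
      ; only = only }
      where
      P = paths H i
      r = fromPath P
      positions = inner-position a 0<a a<len
      j₁ = proj₁ positions
      j₂ = proj₁ (proj₂ positions)
      s₁ : suc j₁ ≡ a
      s₁ = proj₁ (proj₂ (proj₂ positions))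
      s₂ : inject₁ j₂ ≡ a
      s₂ = proj₂ (proj₂ (proj₂ positions))
      s₂′ : inject₁ j₂ ≡ suc j₁
      s₂′ = trans s₂ (sym s₁)
      only : ∀ {g} → Inc T g (vs P a) → EdgeOf T H g → g ≡ es P j₁ ⊎ g ≡ es P j₂
      only ig (i′ , j′ , refl) with i′ Fin.≟ i
      ... | no i′≢i with joins-ends (joins (paths H i′) j′) ig
      ...   | inj₁ q = ⊥-elim (disjoint H i′ i i′≢i _ a (sym q))
      ...   | inj₂ q = ⊥-elim (disjoint H i′ i i′≢i _ a (sym q))
      only ig (i′ , j′ , refl) | yes refl with edge-ends r j′ a ig
      ... | inj₁ q = inj₂ (cong (es P) (inject₁-injective (trans (sym q) (sym s₂))))
      ... | inj₂ q = inj₁ (cong (es P) (suc-injective (trans (sym q) (sym s₁))))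

    passing-claw : ∀ {v} → degree T v ≡ 3 → (p : PassingThrough v) →
                   ∃[ c ] Claw v (PassingThrough.g₁ p) (PassingThrough.g₂ p) c × ¬ EdgeOf T H c
    passing-claw d3 p =
      let c , k = claw-through₂ d3 inc₁ inc₂ g₁≢g₂
          open Claw k
      in c , k , λ ec → [ a≢c ∘ sym , b≢c ∘ sym ] (only inc-c ec)
      where open PassingThrough p

    module _ {x} (ind : IsIndicator' T H x) where

      private
        w≡1 : ∀ {e} → EdgeOf T H e → w x e ≡ 1ℚ
        w≡1 {e} = proj₁ (proj₁ ind e)
        w≡0 : ∀ {e} → ¬ EdgeOf T H e → w x e ≡ 0ℚ
        w≡0 {e} = proj₂ (proj₁ ind e)
        z≡1 : ∀ {v} → InnerNodeOf T H (proj₁ v) → z x v ≡ 1ℚ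
        z≡1 {v} = proj₁ (proj₂ ind v)
        z≡0 : ∀ {v} → ¬ InnerNodeOf T H (proj₁ v) → z x v ≡ 0ℚ
        z≡0 {v} = proj₂ (proj₂ ind v)

      indicator-w : ∀ e → ZeroOrOne (w x e)
      indicator-w e with edgeOf? e
      ... | yes ∈H = inj₂ (w≡1 ∈H)
      ... | no ∉H  = inj₁ (w≡0 ∉H)

      indicator-z : ∀ v → ZeroOrOne (z x v)
      indicator-z v with innerNodeOf? (proj₁ v)
      ... | yes inner = inj₂ (z≡1 {v} inner)
      ... | no ¬inner = inj₁ (z≡0 {v} ¬inner)

      indicator-claw-constraints : ClawConstraints x
      indicator-claw-constraints {v} d3 k with innerNodeOf? v
      ... | yes inner =
        let p = inner⇒passing inner
            _ , k₀ , ∉H = passing-claw d3 p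
            open PassingThrough p
        in nc-any-claw (w x) (z x (v , d3)) d3 k₀ k
             (nc-cong (w≡1 edge₁) (w≡1 edge₂) (w≡0 ∉H) (z≡1 {v , d3} inner) nc-1-1-0)
      ... | no ¬inner =
        let open Claw k
            off : ∀ {g} → Inc T g v → w x g ≡ 0ℚ
            off ig = w≡0 (¬inner ∘ edge⇒inner d3 ig)
        in nc-cong (off inc-a) (off inc-b) (off inc-c) (z≡0 {v , d3} ¬inner) nc-0-0-0

      indicator⇒vertex : IsVertexQ T x
      indicator⇒vertex = inQ , extreme
        where
        inQ : InQ T x
        inQ = claw-constraints⇒inQ indicator-claw-constraints (λ _ e → zeroOrOne-bounds (indicator-w e))
        extreme : ∀ y y′ l → InQ T y → InQ T y′ → 0ℚ < l → l < 1ℚ →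
                  _≈P_ T x (combo T l y y′) → _≈P_ T y x × _≈P_ T y′ x
        extreme y y′ l inQy inQy′ 0<l l<1 (w≡ , z≡) =
          ((proj₁ ∘ on-w) , (proj₁ ∘ on-z)) , ((proj₂ ∘ on-w) , (proj₂ ∘ on-z))
          where
          on-w : ∀ e → w y e ≡ w x e × w y′ e ≡ w x e
          on-w e = zeroOrOne-extreme 0<l l<1 (w-bounds inQy e) (w-bounds inQy′ e) (indicator-w e) (w≡ e)
          on-z : ∀ v → z y v ≡ z x v × z y′ v ≡ z x v
          on-z v = zeroOrOne-extreme 0<l l<1 (z-bounds inQy v) (z-bounds inQy′ v) (indicator-z v) (z≡ v)

-- Vertices are integral

prefix-xor : ∀ {n} → (Fin n → Bool) → Fin (suc n) → Bool
prefix-xor         f zero    = false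
prefix-xor {suc n} f (suc j) = f zero xor prefix-xor (f ∘ suc) j

prefix-xor-step : ∀ {n} (f : Fin n → Bool) i → prefix-xor f (suc i) ≡ f i xor prefix-xor f (inject₁ i)
prefix-xor-step {suc n} f zero    = refl
prefix-xor-step {suc n} f (suc i) = begin
  f zero xor prefix-xor (f ∘ suc) (suc i) ≡⟨ cong (f zero xor_) (prefix-xor-step (f ∘ suc) i) ⟩
  f zero xor (f (suc i) xor rest)         ≡⟨ sym (xor-assoc (f zero) (f (suc i)) rest) ⟩
  (f zero xor f (suc i)) xor rest         ≡⟨ cong (_xor rest) (xor-comm (f zero) (f (suc i))) ⟩
  (f (suc i) xor f zero) xor rest         ≡⟨ xor-assoc (f (suc i)) (f zero) rest ⟩
  f (suc i) xor (f zero xor rest)         ∎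
  where
  open ≡-Reasoning
  rest = prefix-xor (f ∘ suc) (inject₁ i)

sign : Bool → ℚ
sign false = 1ℚ
sign true  = - 1ℚ

sign-bounds : ∀ {ε t} → - ε ≤ t → t ≤ ε → ∀ b → - ε ≤ t * sign b × t * sign b ≤ ε
sign-bounds {ε} {t} -ε≤t t≤ε false =
  subst (- ε ≤_) (sym (*-identityʳ t)) -ε≤t , subst (_≤ ε) (sym (*-identityʳ t)) t≤ε
sign-bounds {ε} {t} -ε≤t t≤ε true =
  subst (- ε ≤_) -t≡ (neg-antimono-≤ t≤ε) ,
  subst (_≤ ε) -t≡ (subst (- t ≤_) (solve 1 (λ ε → :- (:- ε) := ε) refl ε) (neg-antimono-≤ -ε≤t))
  where
  -t≡ : - t ≡ t * - 1ℚ
  -t≡ = solve 1 (λ t → :- t := t :* (:- con 1ℚ)) refl t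

sign-not : ∀ t b → t * sign (not b) ≡ - (t * sign b)
sign-not t false = solve 1 (λ t → t :* (:- con 1ℚ) := :- (t :* con 1ℚ)) refl t
sign-not t true  = solve 1 (λ t → t :* con 1ℚ := :- (t :* (:- con 1ℚ))) refl t

module Integrality (T : Graph) (isT : Is13Tree T) {x : Point T} (vertex : IsVertexQ T x) where
  open Graph T
  open GraphFacts T
  open TreeFacts T isT
  open PointFacts T isT

  W : Fin nE → ℚ
  W = w x

  constraints : ClawConstraints x
  constraints = inQ⇒claw-constraints (proj₁ vertex)

  Fractional : Fin nE → Set
  Fractional e = 0ℚ < W e × W e < 1ℚ

  fractional? : ∀ e → Dec (Fractional e)
  fractional? e = (0ℚ <? W e) ×-dec (W e <? 1ℚ)

  ¬fractional⇒zeroOrOne : ∀ e → ¬ Fractional e → ZeroOrOne (W e)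
  ¬fractional⇒zeroOrOne e ¬fe with W e ℚ.≟ 0ℚ | W e ℚ.≟ 1ℚ
  ... | yes w≡0 | _       = inj₁ w≡0
  ... | no _    | yes w≡1 = inj₂ w≡1
  ... | no w≢0  | no w≢1  =
    let 0≤w , w≤1 = w-bounds (proj₁ vertex) e
    in ⊥-elim (¬fe (≤∧≢⇒< 0≤w (w≢0 ∘ sym) , ≤∧≢⇒< w≤1 w≢1))

  fractional-no-dead-ends : NoDeadEnds Fractional
  fractional-no-dead-ends {v} {e} d3 fe ie =
    let b , c , k = claw-through d3 ie in continue b c k (fractional? b) (fractional? c)
    where
    continue : ∀ b c → Claw v e b c → Dec (Fractional b) → Dec (Fractional c) →
               ∃[ f ] Fractional f × f ≢ e × Inc T f v
    continue b c k (yes fb) _        = b , fb , Claw.a≢b k ∘ sym , Claw.inc-b k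
    continue b c k (no _)   (yes fc) = c , fc , Claw.a≢c k ∘ sym , Claw.inc-c k
    continue b c k (no ¬fb) (no ¬fc) =
      ⊥-elim (¬nc-fractional-integral-integral (constraints d3 k) (proj₁ fe) (proj₂ fe)
                (¬fractional⇒zeroOrOne b ¬fb) (¬fractional⇒zeroOrOne c ¬fc))

  pair-slack cap-slack : Fin nE → Fin nE → Fin nE → ℚ
  pair-slack a b c = (W a + W b) - W c
  cap-slack  a b c = (1ℚ + 1ℚ) - (W a + W b + W c)

  -- The slacks which a small perturbation along a fractional path must not exhaust.
  slacks : Fin nE → Fin nE → Fin nE → Fin 4 → ℚ
  slacks a b c zero                   = pair-slack a b c
  slacks a b c (suc zero)             = cap-slack a b c
  slacks a b c (suc (suc zero))       = W a
  slacks a b c (suc (suc (suc zero))) = 1ℚ - W a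

  slack-bound : Fin nE → Fin nE → Fin nE → ℚ
  slack-bound a b c = minimum (posOr1 ∘ slacks a b c)

  δ : ℚ
  δ = minimum λ a → minimum λ b → minimum (slack-bound a b)

  0<δ : 0ℚ < δ
  0<δ = minimum-pos (λ a → minimum λ b → minimum (slack-bound a b)) λ a →
        minimum-pos (λ b → minimum (slack-bound a b)) λ b →
        minimum-pos (slack-bound a b) λ c →
        minimum-pos (posOr1 ∘ slacks a b c) λ k → posOr1-pos (slacks a b c k)

  δ≤slacks : ∀ a b c k → 0ℚ < slacks a b c k → δ ≤ slacks a b c k
  δ≤slacks a b c k 0<s = subst (δ ≤_) (posOr1-≡ 0<s)
    (≤-trans (minimum-≤ (λ a → minimum λ b → minimum (slack-bound a b)) a)
    (≤-trans (minimum-≤ (λ b → minimum (slack-bound a b)) b)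
    (≤-trans (minimum-≤ (slack-bound a b) c) (minimum-≤ (posOr1 ∘ slacks a b c) k))))

  δ≤pair-slack : ∀ a b c → 0ℚ < pair-slack a b c → δ ≤ pair-slack a b c
  δ≤pair-slack a b c = δ≤slacks a b c zero

  δ≤cap-slack : ∀ a b c → 0ℚ < cap-slack a b c → δ ≤ cap-slack a b c
  δ≤cap-slack a b c = δ≤slacks a b c (suc zero)

  δ≤w : ∀ a → Fractional a → δ ≤ W a
  δ≤w a (0<w , _) = δ≤slacks a a a (suc (suc zero)) 0<w

  δ≤1-w : ∀ a → Fractional a → δ ≤ 1ℚ - W a
  δ≤1-w a (_ , w<1) = δ≤slacks a a a (suc (suc (suc zero))) (p<q⇒0<q-p w<1)

  ε : ℚ
  ε = ½ * δ

  ε+ε≡δ : ε + ε ≡ δ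
  ε+ε≡δ = solve 1 (λ d → con ½ :* d :+ con ½ :* d := d) refl δ

  0<ε : 0ℚ < ε
  0<ε = 0<* 0<½ 0<δ

  ε≤δ : ε ≤ δ
  ε≤δ = 0≤q-p⇒p≤q (0≤-by (solve 1 (λ d → d :- con ½ :* d := con ½ :* d) refl δ) (<⇒≤ 0<ε))

  -ε≤ε : - ε ≤ ε
  -ε≤ε = 0≤q-p⇒p≤q (0≤-by (solve 1 (λ e → e :- (:- e) := e :+ e) refl ε) (0≤+ (<⇒≤ 0<ε) (<⇒≤ 0<ε)))

  module Perturbation {m} (r : IPath (suc m)) (fractional : ∀ j → Fractional (edge r j))
                      (leaf-start : Leaf T (node r zero)) (leaf-finish : Leaf T (node r (fromℕ (suc m)))) where

    inner : Fin m → Fin nV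
    inner i = node r (suc (inject₁ i))

    before after : Fin m → Fin nE
    before i = edge r (inject₁ i)
    after  i = edge r (suc i)

    before≢after : ∀ i → before i ≢ after i
    before≢after i e = suc≢inject₁ (sym (edge-injective r (inject₁ i) (suc i) e))

    OppositeShift : Fin m → Fin nE → Set
    OppositeShift i c = c ≢ before i × c ≢ after i × Inc T c (inner i) ×
                        0ℚ < pair-slack (after i) c (before i) × 0ℚ < pair-slack (before i) c (after i)

    oppositeShift? : ∀ i c → Dec (OppositeShift i c)
    oppositeShift? i c = ¬? (c Fin.≟ before i) ×-dec ¬? (c Fin.≟ after i) ×-dec inc? T c (inner i) ×-dec
                         (0ℚ <? pair-slack (after i) c (before i)) ×-dec (0ℚ <? pair-slack (before i) c (after i))

    -- Where the two path edges at an inner node can move in opposite directions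
    -- the sign flips; otherwise both move together and z absorbs the change.
    flips : Fin m → Bool
    flips i = ⌊ any? (oppositeShift? i) ⌋

    flips-spec : ∀ i → (flips i ≡ true × ∃ (OppositeShift i)) ⊎ (flips i ≡ false × ¬ ∃ (OppositeShift i))
    flips-spec i with any? (oppositeShift? i)
    ... | yes opp = inj₁ (refl , opp)
    ... | no ¬opp = inj₂ (refl , ¬opp)

    signs : Fin (suc m) → Bool
    signs = prefix-xor flips

    direction : Fin nE → ℚ
    direction e with any? (λ j → edge r j Fin.≟ e)
    ... | yes (j , _) = sign (signs j)
    ... | no _        = 0ℚ

    direction-on : ∀ j → direction (edge r j) ≡ sign (signs j)
    direction-on j with any? (λ j′ → edge r j′ Fin.≟ edge r j)
    ... | yes (j′ , e) = cong (sign ∘ signs) (edge-injective r j′ j e)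
    ... | no ¬on       = ⊥-elim (¬on (j , refl))

    direction-off : ∀ e → (∀ j → edge r j ≢ e) → direction e ≡ 0ℚ
    direction-off e off with any? (λ j → edge r j Fin.≟ e)
    ... | yes (j , on) = ⊥-elim (off j on)
    ... | no _         = refl

    node-shift : Fin nV → ℚ
    node-shift v = sum λ e → if ⌊ inc? T e v ⌋ then direction e else 0ℚ

    node-shift-claw : ∀ {v a b c} → degree T v ≡ 3 → Claw v a b c →
                      node-shift v ≡ direction a + direction b + direction c
    node-shift-claw {v} {a} {b} {c} d3 k@(claw a≢b a≢c b≢c ia ib ic) =
      trans (sum-supported-on-three f (a≢b ∘ sym) (a≢c ∘ sym) (b≢c ∘ sym) vanishes)
            (cong₂ _+_ (cong₂ _+_ (on ia) (on ib)) (on ic))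
      where
      f : Fin nE → ℚ
      f e = if ⌊ inc? T e v ⌋ then direction e else 0ℚ
      on : ∀ {e} → Inc T e v → f e ≡ direction e
      on ie = cong (λ β → if β then direction _ else 0ℚ) (inc⇒counted ie)
      vanishes : ∀ e → e ≢ a → e ≢ b → e ≢ c → f e ≡ 0ℚ
      vanishes e e≢a e≢b e≢c with inc? T e v
      ... | yes ie = ⊥-elim ([ e≢a , [ e≢b , e≢c ] ] (claw-complete d3 k ie))
      ... | no _   = refl

    module PathNode (i : Fin m) (d3 : degree T (inner i) ≡ 3) where

      third : Fin nE
      third = proj₁ (claw-through₂ d3 (edge-inc₂ r (inject₁ i)) (edge-inc₁ r (suc i)) (before≢after i))

      claw₀ : Claw (inner i) (before i) (after i) third
      claw₀ = proj₂ (claw-through₂ d3 (edge-inc₂ r (inject₁ i)) (edge-inc₁ r (suc i)) (before≢after i))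

      open Claw claw₀

      third-fixed : direction third ≡ 0ℚ
      third-fixed = direction-off third λ j on →
        case j on (edge-ends r j (suc (inject₁ i)) (subst (λ e → Inc T e (inner i)) (sym on) inc-c))
        where
        case : ∀ j → edge r j ≡ third → suc (inject₁ i) ≡ inject₁ j ⊎ suc (inject₁ i) ≡ suc j → ⊥
        case j on (inj₁ e) = b≢c (trans (cong (edge r) (inject₁-injective {i = suc i} e)) on)
        case j on (inj₂ e) = a≢c (trans (cong (edge r) (suc-injective e)) on)

      direction-before : direction (before i) ≡ sign (signs (inject₁ i))
      direction-before = direction-on (inject₁ i)

      direction-after : direction (after i) ≡ sign (flips i xor signs (inject₁ i))
      direction-after = trans (direction-on (suc i)) (cong sign (prefix-xor-step flips i))

      node-shift-inner : node-shift (inner i) ≡ sign (signs (inject₁ i)) + sign (flips i xor signs (inject₁ i)) + 0ℚ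
      node-shift-inner = trans (node-shift-claw d3 claw₀)
                               (cong₂ _+_ (cong₂ _+_ direction-before direction-after) third-fixed)

    -- As Σ_{e ∋ v} w_e = 2 z_v, z_v moves by half the total shift at v.
    perturbed : ℚ → Point T
    perturbed t = ⟨ (λ e → W e + t * direction e) , (λ v → z x v + t * node-shift (proj₁ v) * ½) ⟩

    module _ {t} (-ε≤t : - ε ≤ t) (t≤ε : t ≤ ε) where

      private
        Wt : Fin nE → ℚ
        Wt = w (perturbed t)

        unshifted : ∀ {e} → direction e ≡ 0ℚ → Wt e ≡ W e
        unshifted {e} d≡0 = trans (cong (λ d → W e + t * d) d≡0) (trans (cong (W e +_) (*-zeroʳ t)) (+-identityʳ (W e)))

        2ε≤ : ∀ {s} → δ ≤ s → ε + ε ≤ s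
        2ε≤ = subst (_≤ _) (sym ε+ε≡δ)

      module _ (i : Fin m) (d3 : degree T (inner i) ≡ 3) where
        open PathNode i d3

        private
          Z = z x (inner i , d3)
          s = signs (inject₁ i)
          u = t * sign s
          -ε≤u = proj₁ (sign-bounds -ε≤t t≤ε s)
          u≤ε  = proj₂ (sign-bounds -ε≤t t≤ε s)
          base : NodeConstraints (W (before i)) (W (after i)) (W third) Z
          base = constraints d3 claw₀
          shifted-z : ∀ {β} → flips i ≡ β →
                      z (perturbed t) (inner i , d3) ≡ Z + t * (sign s + sign (β xor s) + 0ℚ) * ½
          shifted-z flip = cong (λ D → Z + t * D * ½)
                             (trans node-shift-inner (cong (λ β → sign s + sign (β xor s) + 0ℚ) flip))
          shifted-after : ∀ {β} → flips i ≡ β → Wt (after i) ≡ W (after i) + t * sign (β xor s)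
          shifted-after flip = cong (λ d → W (after i) + t * d) (trans direction-after (cong (λ β → sign (β xor s)) flip))

        move-apart : flips i ≡ true → ∃ (OppositeShift i) →
                     NodeConstraints (Wt (before i)) (Wt (after i)) (Wt third) (z (perturbed t) (inner i , d3))
        move-apart flip (c , c≢before , c≢after , ic , slack₁ , slack₂) =
          nc-cong (cong (λ d → W (before i) + t * d) direction-before)
                  (trans (shifted-after flip) (cong (W (after i) +_) (sign-not t s)))
                  (unshifted third-fixed) (trans (shifted-z flip) (cancels s))
            (nc-shift-opposite base room₁ room₂ -ε≤u u≤ε)
          where
          c≡third : c ≡ third
          c≡third with claw-complete d3 claw₀ ic
          ... | inj₁ c≡before       = ⊥-elim (c≢before c≡before)
          ... | inj₂ (inj₁ c≡after) = ⊥-elim (c≢after c≡after)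
          ... | inj₂ (inj₂ c≡third) = c≡third
          room₁ : ε + ε ≤ pair-slack (after i) third (before i)
          room₁ = 2ε≤ (δ≤pair-slack (after i) third (before i)
                        (subst (λ e → 0ℚ < pair-slack (after i) e (before i)) c≡third slack₁))
          room₂ : ε + ε ≤ pair-slack (before i) third (after i)
          room₂ = 2ε≤ (δ≤pair-slack (before i) third (after i)
                        (subst (λ e → 0ℚ < pair-slack (before i) e (after i)) c≡third slack₂))
          cancels : ∀ s → Z + t * (sign s + sign (not s) + 0ℚ) * ½ ≡ Z
          cancels false = solve 2 (λ Z t → Z :+ t :* (con 1ℚ :+ (:- con 1ℚ) :+ con 0ℚ) :* con ½ := Z) refl Z t
          cancels true  = solve 2 (λ Z t → Z :+ t :* ((:- con 1ℚ) :+ con 1ℚ :+ con 0ℚ) :* con ½ := Z) refl Z t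

        move-together : flips i ≡ false → ¬ ∃ (OppositeShift i) →
                        NodeConstraints (Wt (before i)) (Wt (after i)) (Wt third) (z (perturbed t) (inner i , d3))
        move-together flip ¬apart =
          nc-cong (cong (λ d → W (before i) + t * d) direction-before) (shifted-after flip) (unshifted third-fixed)
                  (trans (shifted-z flip)
                         (solve 3 (λ Z t σ → Z :+ t :* (σ :+ σ :+ con 0ℚ) :* con ½ := Z :+ t :* σ) refl Z t (sign s)))
            (nc-shift-both base (2ε≤ (δ≤pair-slack (before i) (after i) third pair))
                                (2ε≤ (δ≤cap-slack (before i) (after i) third cap)) -ε≤u u≤ε)
          where
          open Claw claw₀
          slacks-together =
            slack-choice (proj₁ (fractional (inject₁ i))) (proj₂ (fractional (inject₁ i)))
                         (proj₁ (fractional (suc i))) (proj₂ (fractional (suc i)))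
                         (λ (slack₁ , slack₂) → ¬apart (third , a≢c ∘ sym , b≢c ∘ sym , inc-c , slack₁ , slack₂))
          pair = proj₁ slacks-together
          cap  = proj₂ slacks-together

        path-node-constraints : NodeConstraints (Wt (before i)) (Wt (after i)) (Wt third) (z (perturbed t) (inner i , d3))
        path-node-constraints = [ uncurry move-apart , uncurry move-together ]′ (flips-spec i)

      perturbed-claw-constraints : ClawConstraints (perturbed t)
      perturbed-claw-constraints {v} {a} {b} {c} d3 k = by-position (any? λ n → node r n Fin.≟ v)
        where
        open Claw k
        Zt = z (perturbed t) (v , d3)
        by-position : Dec (∃ λ n → node r n ≡ v) → NodeConstraints (Wt a) (Wt b) (Wt c) Zt
        by-position (yes (zero , refl)) = ⊥-elim (leaf≢internal leaf-start d3)
        by-position (yes (suc n , refl)) with last-or-inject₁ n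
        ... | inj₁ refl = ⊥-elim (leaf≢internal leaf-finish d3)
        ... | inj₂ (i , refl) = nc-any-claw Wt Zt d3 (PathNode.claw₀ i d3) k (path-node-constraints i d3)
        by-position (no off-path) =
          nc-cong (unshifted (still inc-a)) (unshifted (still inc-b)) (unshifted (still inc-c)) Zt≡Z (constraints d3 k)
          where
          still : ∀ {e} → Inc T e v → direction e ≡ 0ℚ
          still ie = direction-off _ λ j on → [ off-path ∘ (inject₁ j ,_) ∘ sym , off-path ∘ (suc j ,_) ∘ sym ]
                                                 (joins-ends (link r j) (subst (λ g → Inc T g v) (sym on) ie))
          Zt≡Z : Zt ≡ z x (v , d3)
          Zt≡Z = trans (cong (λ D → z x (v , d3) + t * D * ½)
                         (trans (node-shift-claw d3 k) (cong₂ _+_ (cong₂ _+_ (still inc-a) (still inc-b)) (still inc-c))))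
                       (solve 2 (λ Z t → Z :+ t :* (con 0ℚ :+ con 0ℚ :+ con 0ℚ) :* con ½ := Z) refl (z x (v , d3)) t)

      perturbed-w-bounds : ∀ e → 0ℚ ≤ Wt e × Wt e ≤ 1ℚ
      perturbed-w-bounds e = by-edge e (any? λ j → edge r j Fin.≟ e)
        where
        by-edge : ∀ e → Dec (∃ λ j → edge r j ≡ e) → 0ℚ ≤ Wt e × Wt e ≤ 1ℚ
        by-edge e (no off) = subst (λ y → 0ℚ ≤ y × y ≤ 1ℚ) (sym (unshifted (direction-off e λ j on → off (j , on))))
                                   (w-bounds (proj₁ vertex) e)
        by-edge _ (yes (j , refl)) =
          0≤-by (trans shifted (solve 3 (λ w u ε → w :+ u := (w :- ε) :+ (u :+ ε)) refl (W e′) u ε))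
                (0≤+ (p≤q⇒0≤q-p (≤-trans ε≤δ (δ≤w e′ (fractional j)))) (-q≤p⇒0≤p+q -ε≤u)) ,
          0≤q-p⇒p≤q (0≤-by (trans (cong (λ y → 1ℚ - y) shifted)
                                   (solve 3 (λ w u ε → con 1ℚ :- (w :+ u) := ((con 1ℚ :- w) :- ε) :+ (ε :- u)) refl (W e′) u ε))
                            (0≤+ (p≤q⇒0≤q-p (≤-trans ε≤δ (δ≤1-w e′ (fractional j)))) (p≤q⇒0≤q-p u≤ε)))
          where
          e′ = edge r j
          u = t * sign (signs j)
          -ε≤u = proj₁ (sign-bounds -ε≤t t≤ε (signs j))
          u≤ε  = proj₂ (sign-bounds -ε≤t t≤ε (signs j))
          shifted : Wt e′ ≡ W e′ + u
          shifted = cong (λ d → W e′ + t * d) (direction-on j)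

      perturbed-inQ : InQ T (perturbed t)
      perturbed-inQ = claw-constraints⇒inQ perturbed-claw-constraints (λ _ → perturbed-w-bounds)

    -- x is the midpoint of perturbed ε and perturbed (- ε), so it is not a vertex.
    midpoint-contradiction : ⊥
    midpoint-contradiction = <-irrefl (sym ε≡0) 0<ε
      where
      midpoint : _≈P_ T x (combo T ½ (perturbed ε) (perturbed (- ε)))
      midpoint =
        (λ e → solve 3 (λ w ε d → w := con ½ :* (w :+ ε :* d) :+ (con 1ℚ :- con ½) :* (w :+ (:- ε) :* d))
                       refl (W e) ε (direction e)) ,
        (λ v → solve 3 (λ z ε D → z := con ½ :* (z :+ ε :* D :* con ½)
                                           :+ (con 1ℚ :- con ½) :* (z :+ (:- ε) :* D :* con ½))
                       refl (z x v) ε (node-shift (proj₁ v)))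
      e₀ = edge r zero
      unmoved : W e₀ + ε * direction e₀ ≡ W e₀
      unmoved = proj₁ (proj₁ (proj₂ vertex (perturbed ε) (perturbed (- ε)) ½
                  (perturbed-inQ -ε≤ε ≤-refl) (perturbed-inQ ≤-refl -ε≤ε) 0<½ ½<1 midpoint)) e₀
      ε≡0 : ε ≡ 0ℚ
      ε≡0 = begin
        ε                           ≡⟨ solve 2 (λ w ε → ε := (w :+ ε :* con 1ℚ) :- w) refl (W e₀) ε ⟩
        (W e₀ + ε * 1ℚ) - W e₀      ≡⟨ cong (λ d → (W e₀ + ε * d) - W e₀) (sym (direction-on zero)) ⟩
        (W e₀ + ε * direction e₀) - W e₀ ≡⟨ cong (_- W e₀) unmoved ⟩
        W e₀ - W e₀                 ≡⟨ +-inverseʳ (W e₀) ⟩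
        0ℚ                          ∎
        where open ≡-Reasoning

  vertex⇒zeroOrOne : ∀ e → ZeroOrOne (W e)
  vertex⇒zeroOrOne e with fractional? e
  ... | no ¬fe = ¬fractional⇒zeroOrOne e ¬fe
  ... | yes fe = ⊥-elim (no-fractional-leaf-path (fromPath path) (proj₁ leaf-path) along-S
                           (proj₁ (proj₂ leaf-path)) (proj₂ (proj₂ leaf-path)))
    where
    open LeafPathThrough (leaf-path-through Fractional fractional-no-dead-ends fe)
    no-fractional-leaf-path : ∀ {n} (r : IPath n) → 1 ℕ.≤ n → (∀ j → Fractional (edge r j)) →
                              Leaf T (node r zero) → Leaf T (node r (fromℕ n)) → ⊥
    no-fractional-leaf-path {suc m} r _ fractional leaf-start leaf-finish =
      Perturbation.midpoint-contradiction r fractional leaf-start leaf-finish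

-- Integral points of Q_T are indicator points

module Decomposition (T : Graph) (isT : Is13Tree T) {x : Point T} (inQ : InQ T x)
                     (integral : ∀ e → ZeroOrOne (w x e)) where
  open Graph T
  open GraphFacts T
  open TreeFacts T isT
  open PointFacts T isT

  W : Fin nE → ℚ
  W = w x

  constraints : ClawConstraints x
  constraints = inQ⇒claw-constraints inQ

  One : Fin nE → Set
  One e = W e ≡ 1ℚ

  one-no-dead-ends : NoDeadEnds One
  one-no-dead-ends {v} {e} d3 one ie =
    let b , c , k = claw-through d3 ie in continue b c k (integral b) (integral c)
    where
    continue : ∀ b c → Claw v e b c → ZeroOrOne (W b) → ZeroOrOne (W c) →
               ∃[ f ] One f × f ≢ e × Inc T f v
    continue b c k (inj₂ one-b) _          = b , one-b , Claw.a≢b k ∘ sym , Claw.inc-b k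
    continue b c k (inj₁ _)     (inj₂ one-c) = c , one-c , Claw.a≢c k ∘ sym , Claw.inc-c k
    continue b c k (inj₁ zero-b) (inj₁ zero-c) =
      ⊥-elim (¬nc-1-0-0 (nc-cong (sym one) (sym zero-b) (sym zero-c) refl (constraints d3 k)))

  -- At an internal node at most two incident edges carry weight 1, since z ≤ 1.
  one-edge-on-path : (P : Path T) → LeafPath T P → (∀ j → One (es P j)) →
                     ∀ a {g} → One g → Inc T g (vs P a) → ∃[ j ] es P j ≡ g
  one-edge-on-path P leaf-path along a {g} one-g ig with leaf-or-internal (vs P a)
  ... | inj₁ leaf = j , leaf-edge-unique leaf (at-position position) ig
    where
    j = proj₁ (adjacent-step (proj₁ leaf-path) a)
    position = proj₂ (adjacent-step (proj₁ leaf-path) a)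
    at-position : inject₁ j ≡ a ⊎ suc j ≡ a → Inc T (es P j) (vs P a)
    at-position (inj₁ e) = subst (Inc T (es P j) ∘ vs P) e (edge-inc₁ (fromPath P) j)
    at-position (inj₂ e) = subst (Inc T (es P j) ∘ vs P) e (edge-inc₂ (fromPath P) j)
  ... | inj₂ d3 = by-position (leaf-or-inner-position P leaf-path a)
    where
    by-position : Leaf T (vs P a) ⊎ (0 ℕ.< toℕ a × toℕ a ℕ.< len P) → ∃[ j ] es P j ≡ g
    by-position (inj₁ leaf) = ⊥-elim (leaf≢internal leaf d3)
    by-position (inj₂ (0<a , a<len)) with inner-position a 0<a a<len
    ... | j₁ , j₂ , refl , s₂ with claw-through₂ d3 (edge-inc₂ (fromPath P) j₁)
                                     (subst (Inc T (es P j₂) ∘ vs P) s₂ (edge-inc₁ (fromPath P) j₂)) p≢q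
      where
      p≢q : es P j₁ ≢ es P j₂
      p≢q e = suc≢inject₁ (trans (sym s₂) (cong inject₁ (sym (edge-injective (fromPath P) j₁ j₂ e))))
    ...   | c , k with claw-complete d3 k ig
    ...     | inj₁ g≡p        = j₁ , sym g≡p
    ...     | inj₂ (inj₁ g≡q) = j₂ , sym g≡q
    ...     | inj₂ (inj₂ g≡c) = ⊥-elim (1≢0 (trans (sym one-g) (trans (cong W g≡c) zero-c)))
      where
      zero-c : W c ≡ 0ℚ
      zero-c = proj₁ (nc-1-1⇒0-1 (nc-cong (sym (along j₁)) (sym (along j₂)) refl refl (constraints d3 k))
                                 (integral c))

  meeting⇒contained : (P Q : Path T) → LeafPath T P → (∀ j → One (es P j)) → (∀ j → One (es Q j)) →
                      ∀ a b → vs Q b ≡ vs P a → ∀ j → ∃[ j′ ] es P j′ ≡ es Q j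
  meeting⇒contained P Q leaf-path along-P along-Q a b meet j =
    let a′ , on = on-P (inject₁ j)
    in one-edge-on-path P leaf-path along-P a′ (along-Q j)
                        (subst (Inc T (es Q j)) on (edge-inc₁ (fromPath Q) j))
    where
    OnP : Fin (suc (len Q)) → Set
    OnP k = ∃[ a′ ] vs Q k ≡ vs P a′
    across : ∀ {k k′} i → Inc T (es Q i) (vs Q k) → Inc T (es Q i) (vs Q k′) → OnP k → OnP k′
    across i ik ik′ (a′ , on)
      with one-edge-on-path P leaf-path along-P a′ (along-Q i) (subst (Inc T (es Q i)) on ik)
    ... | j′ , same with joins-ends (joins P j′) (subst (λ g → Inc T g (vs Q _)) (sym same) ik′)
    ...   | inj₁ on′ = inject₁ j′ , on′
    ...   | inj₂ on′ = suc j′ , on′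
    on-P : ∀ k → OnP k
    on-P = propagate-forward OnP (λ i → across i (edge-inc₁ (fromPath Q) i) (edge-inc₂ (fromPath Q) i))
             (propagate-backward OnP (λ i → across i (edge-inc₂ (fromPath Q) i) (edge-inc₁ (fromPath Q) i))
                                 b (a , meet))

  record Packing : Set where
    field
      collection : DisjointLeafPaths T
      all-one    : ∀ i j → One (es (paths collection i) j)

  open Packing

  empty-packing : Packing
  empty-packing = record
    { collection = record { size = 0 ; paths = λ () ; leafpath = λ () ; disjoint = λ () } ; all-one = λ () }

  add-path : (pk : Packing) (P : Path T) → LeafPath T P → (∀ j → One (es P j)) →
             (∀ i a b → vs (paths (collection pk) i) a ≢ vs P b) → Packing
  add-path pk P leaf-path along fresh = record
    { collection = record { size = suc (size H) ; paths = paths′ ; leafpath = leafpath′ ; disjoint = disjoint′ }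
    ; all-one = all-one′ }
    where
    H = collection pk
    paths′ : Fin (suc (size H)) → Path T
    paths′ zero    = P
    paths′ (suc i) = paths H i
    leafpath′ : ∀ i → LeafPath T (paths′ i)
    leafpath′ zero    = leaf-path
    leafpath′ (suc i) = leafpath H i
    disjoint′ : ∀ i j → i ≢ j → ∀ a b → vs (paths′ i) a ≢ vs (paths′ j) b
    disjoint′ zero    zero    i≢j = ⊥-elim (i≢j refl)
    disjoint′ zero    (suc j) _   a b e = fresh j b a (sym e)
    disjoint′ (suc i) zero    _   a b e = fresh i a b e
    disjoint′ (suc i) (suc j) i≢j = disjoint H i j (i≢j ∘ cong suc)
    all-one′ : ∀ i j → One (es (paths′ i) j)
    all-one′ zero    = along
    all-one′ (suc i) = all-one pk i

  Covers : List (Fin nE) → Packing → Set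
  Covers l pk = ∀ {e} → e ∈ l → One e → EdgeOf T (collection pk) e

  pack-edge : ∀ e {l} (pk : Packing) → Covers l pk → ZeroOrOne (W e) → Dec (EdgeOf T (collection pk) e) →
              Σ Packing (Covers (e ∷ l))
  pack-edge e pk covers (inj₁ zero-e) _ =
    pk , λ { (here refl) one-e → ⊥-elim (1≢0 (trans (sym one-e) zero-e)) ; (there m) → covers m }
  pack-edge e pk covers (inj₂ _) (yes covered) =
    pk , λ { (here refl) _ → covered ; (there m) → covers m }
  pack-edge e pk covers (inj₂ one-e) (no uncovered) =
    add-path pk path leaf-path along-S fresh ,
    λ { (here refl) _ → zero , through ; (there m) one → let i , j = covers m one in suc i , j }
    where
    open LeafPathThrough (leaf-path-through One one-no-dead-ends one-e)
    H = collection pk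
    fresh : ∀ i a b → vs (paths H i) a ≢ vs path b
    fresh i a b meet =
      let j′ , on = meeting⇒contained (paths H i) path (leafpath H i) (all-one pk i) along-S
                                      a b (sym meet) (proj₁ through)
      in uncovered (i , j′ , trans on (proj₂ through))

  pack : ∀ l → Σ Packing (Covers l)
  pack []      = empty-packing , λ ()
  pack (e ∷ l) = let pk , covers = pack l
                 in pack-edge e pk covers (integral e) (Collection.edgeOf? (collection pk) e)

  decomposition : Σ (DisjointLeafPaths T) (λ H → IsIndicator' T H x)
  decomposition = H , (λ e → on-edge e , off-edge e) , (λ v → inner-node v , other-node v)
    where
    packed = pack (allFin nE)
    H = collection (proj₁ packed)
    open Collection H
    on-edge : ∀ e → EdgeOf T H e → W e ≡ 1ℚ
    on-edge e (i , j , refl) = all-one (proj₁ packed) i j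
    off-edge : ∀ e → ¬ EdgeOf T H e → W e ≡ 0ℚ
    off-edge e ∉H with integral e
    ... | inj₁ zero-e = zero-e
    ... | inj₂ one-e  = ⊥-elim (∉H (proj₂ packed (∈-allFin e) one-e))
    inner-node : ∀ v → InnerNodeOf T H (proj₁ v) → z x v ≡ 1ℚ
    inner-node (v , d3) inner =
      let p = inner⇒passing inner
          c , k , _ = passing-claw d3 p
          open PassingThrough p
          through-v = nc-cong (sym (on-edge g₁ edge₁)) (sym (on-edge g₂ edge₂)) refl refl (constraints d3 k)
      in proj₂ (nc-1-1⇒0-1 through-v (integral c))
    other-node : ∀ v → ¬ InnerNodeOf T H (proj₁ v) → z x v ≡ 0ℚ
    other-node (v , d3) ¬inner =
      let e , ie = internal-edge d3
          _ , _ , k = claw-through d3 ie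
          open Claw k
          off : ∀ {g} → Inc T g v → W g ≡ 0ℚ
          off ig = off-edge _ (¬inner ∘ edge⇒inner d3 ig)
      in nc-0-0-0⇒z≡0 (nc-cong (sym (off inc-a)) (sym (off inc-b)) (sym (off inc-c)) refl (constraints d3 k))

theorem4 : (T : Graph) → Is13Tree T → (x : Point T) →
    IsVertexQ T x ⇔ Σ (DisjointLeafPaths T) (λ H → IsIndicator' T H x)
theorem4 T isT x = mk⇔
  (λ vertex → Decomposition.decomposition T isT (proj₁ vertex) (Integrality.vertex⇒zeroOrOne T isT vertex))
  (λ (H , indicator) → PointFacts.Collection.indicator⇒vertex T isT H indicator)
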